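{- Let $r$ be a positive integer and $k\ge3$ an odd integer. Let $G_1,\dots,G_k$ be vertex-disjoint graphs, each 4-connected, $r$-regular and of class 1, and for each $i$ let $\{e_i,e'_i\}$ be an equivalent set of $G_i$ of size 2 with $e_i=x_iy_i$, $e'_i=x'_iy'_i$. Let $C$ be the graph obtained from $G_1,\dots,G_k$ by deleting $e_i,e'_i$ and adding edges $f_i=x_iy_{i+1}$ and $f'_i=x'_iy'_{i+1}$ for all $i=1,\dots,k$, with indices taken so that $y_{k+1}=y_1$, $y'_{k+1}=y'_1$. Then: (i) $C$ is 4-connected, $r$-regular and of class 1, and $\{f_i,f'_i\}$ is an equivalent set of $C$ for every $i=1,\dots,k$; (ii) if $G_j-\{e_j,e'_j\}$ is not bipartite for some $1\le j\le k$, then $\{f_i,f'_i:i=1,\dots,k\}\in\mathcal{N}^*(C)$.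
   Context: A non-empty edge set $S$ of a graph $H$ is an equivalent set if $S\cap M=\emptyset$ or $S\cap M=S$ for every perfect matching $M$ of $H$. A graph is of class 1 if its edge chromatic number equals its maximum degree. For a matching-covered graph $H$, $X\subseteq E(H)$ is feasible if there are perfect matchings $M_1,M_2$ with $|M_1\cap X|\not\equiv|M_2\cap X|\pmod2$, non-feasible otherwise. $\nabla_H(U)$ is the set of edges with exactly one end in $U$; $X\sim_H Y$ means $X=Y\oplus\nabla_H(U)$ for some $U\subseteq V(H)$. $\mathcal{N}^*(H)$ is the set of non-feasible $X\subseteq E(H)$ with neither $X\sim_H\emptyset$ nor $X\sim_H E(H)$. -}

module Defs where

open import Data.Nat using (ℕ; zero; suc; _<_; _≤_; _%_)
open import Data.Nat.DivMod using (m%n<n)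
open import Data.Fin using (Fin; toℕ; fromℕ<)
import Data.Fin as Fin
open import Data.Bool using (Bool; true; false; _∨_; _xor_; not; T)
import Data.Bool
open import Data.Bool.Properties using (T-irrelevant)
open import Data.Product using (Σ; ∃; _×_; _,_; proj₁; proj₂)
import Data.Product.Properties as ×P
open import Data.Sum using (_⊎_; inj₁; inj₂)
import Data.Sum.Properties as ⊎P
open import Data.Empty using (⊥)
open import Relation.Nullary using (¬_; yes; no)
open import Relation.Nullary.Decidable using (⌊_⌋)
open import Relation.Binary.PropositionalEquality using (_≡_; _≢_; refl)
open import Relation.Binary.Definitions using (DecidableEquality)
open import Function.Bundles using (_↔_)

-- Finiteness is not a field: every notion below that needs a cardinality
-- uses HasSize (a bijection with Fin n), and 4-connectedness requires the
-- vertex set to have a finite size.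

record Graph : Set₁ where
  field
    V    : Set
    E    : Set
    _≟V_ : DecidableEquality V
    _≟E_ : DecidableEquality E
    end₁ : E → V
    end₂ : E → V

open Graph public

HasSize : Set → ℕ → Set
HasSize A n = Fin n ↔ A

module _ (H : Graph) where

  Loopless : Set
  Loopless = ∀ e → end₁ H e ≢ end₂ H e

  endAt : E H → Bool → V H
  endAt e true  = end₁ H e
  endAt e false = end₂ H e

  -- incidences (edge, end) at v; a loop would be counted twice
  Incidences : V H → Set
  Incidences v = Σ (E H) λ e → Σ Bool λ b → endAt e b ≡ v

  Degree : V H → ℕ → Set
  Degree v d = HasSize (Incidences v) d

  Regular : ℕ → Set
  Regular r = ∀ v → Degree v r

  MaxDegree : ℕ → Set
  MaxDegree d = (∀ v n → Degree v n → n ≤ d) × (∃ λ v → Degree v d)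

  Inc : V H → E H → Set
  Inc v e = (end₁ H e ≡ v) ⊎ (end₂ H e ≡ v)

  ProperEdgeColouring : (k : ℕ) → (E H → Fin k) → Set
  ProperEdgeColouring k c =
    ∀ e f → e ≢ f → (∃ λ v → Inc v e × Inc v f) → c e ≢ c f

  EdgeColourable : ℕ → Set
  EdgeColourable k = ∃ λ (c : E H → Fin k) → ProperEdgeColouring k c

  EdgeChromaticNumber : ℕ → Set
  EdgeChromaticNumber k = EdgeColourable k × (∀ j → EdgeColourable j → k ≤ j)

  Class1 : Set
  Class1 = ∃ λ k → EdgeChromaticNumber k × MaxDegree k

  Adj : E H → V H → V H → Set
  Adj e u v = (end₁ H e ≡ u × end₂ H e ≡ v) ⊎ (end₂ H e ≡ u × end₁ H e ≡ v)

  data WalkAvoiding (S : V H → Bool) : V H → V H → Set where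
    stay : ∀ {v} → S v ≡ false → WalkAvoiding S v v
    step : ∀ {u v w} (e : E H) → S u ≡ false → Adj e u v →
           WalkAvoiding S v w → WalkAvoiding S u w

  ConnectedAfterDeleting : (V H → Bool) → Set
  ConnectedAfterDeleting S =
    ∀ u v → S u ≡ false → S v ≡ false → WalkAvoiding S u v

  KConnected : ℕ → Set
  KConnected k =
    (∃ λ n → HasSize (V H) n × k < n) ×
    (∀ (S : V H → Bool) j → HasSize (Σ (V H) λ v → S v ≡ true) j → j < k →
       ConnectedAfterDeleting S)

  Bipartite : Set
  Bipartite = ∃ λ (c : V H → Bool) → ∀ e → c (end₁ H e) ≢ c (end₂ H e)

  EdgeSet : Set
  EdgeSet = E H → Bool

  pair : E H → E H → EdgeSet
  pair a b z = ⌊ _≟E_ H z a ⌋ ∨ ⌊ _≟E_ H z b ⌋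

  PerfectMatching : EdgeSet → Set
  PerfectMatching M = ∀ v → HasSize (Σ (E H) λ e → M e ≡ true × Inc v e) 1

  EquivalentSet : EdgeSet → Set
  EquivalentSet S =
    (∃ λ e → S e ≡ true) ×
    (∀ M → PerfectMatching M →
       (∀ e → S e ≡ true → M e ≡ false) ⊎ (∀ e → S e ≡ true → M e ≡ true))

  InterSize : EdgeSet → EdgeSet → ℕ → Set
  InterSize M X n = HasSize (Σ (E H) λ e → M e ≡ true × X e ≡ true) n

  Feasible : EdgeSet → Set
  Feasible X = ∃ λ M₁ → ∃ λ M₂ → PerfectMatching M₁ × PerfectMatching M₂ ×
    ∃ λ a → ∃ λ b → InterSize M₁ X a × InterSize M₂ X b × (a % 2 ≢ b % 2)

  ∇ : (V H → Bool) → EdgeSet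
  ∇ U e = U (end₁ H e) xor U (end₂ H e)

  _∼_ : EdgeSet → EdgeSet → Set
  X ∼ Y = ∃ λ (U : V H → Bool) → ∀ e → X e ≡ (Y e xor ∇ U e)

  NStar : EdgeSet → Set
  NStar X = ¬ Feasible X × ¬ (X ∼ (λ _ → false)) × ¬ (X ∼ (λ _ → true))

  deleteEdges : EdgeSet → Graph
  deleteEdges S = record
    { V = V H
    ; E = Σ (E H) λ a → T (not (S a))
    ; _≟V_ = _≟V_ H
    ; _≟E_ = ×P.≡-dec (_≟E_ H) (λ p q → yes (T-irrelevant p q))
    ; end₁ = λ a → end₁ H (proj₁ a)
    ; end₂ = λ a → end₂ H (proj₁ a)
    }

next : ∀ {k} → Fin k → Fin k
next {suc n} i = fromℕ< (m%n<n (suc (toℕ i)) (suc n))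

-- The graph C: disjoint union of the G i - {e i , e' i} together with the
-- new edges f i = x i y (i+1)  (inj₂ (i , true)) and
--              f' i = x' i y' (i+1)  (inj₂ (i , false)).
module Construction {k : ℕ} (G : Fin k → Graph)
  (e e' : (i : Fin k) → E (G i))
  (x y x' y' : (i : Fin k) → V (G i)) where

  G⁻ : Fin k → Graph
  G⁻ i = deleteEdges (G i) (pair (G i) (e i) (e' i))

  C : Graph
  C = record
    { V = Σ (Fin k) λ i → V (G i)
    ; E = (Σ (Fin k) λ i → E (G⁻ i)) ⊎ (Fin k × Bool)
    ; _≟V_ = ×P.≡-dec Fin._≟_ (λ {i} → _≟V_ (G i))
    ; _≟E_ = ⊎P.≡-dec (×P.≡-dec Fin._≟_ (λ {i} → _≟E_ (G⁻ i)))
                      (×P.≡-dec Fin._≟_ Data.Bool._≟_)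
    ; end₁ = end₁C
    ; end₂ = end₂C
    }
    where
    end₁C : (Σ (Fin k) λ i → E (G⁻ i)) ⊎ (Fin k × Bool) → Σ (Fin k) λ i → V (G i)
    end₁C (inj₁ (i , a))     = i , end₁ (G⁻ i) a
    end₁C (inj₂ (i , true))  = i , x i
    end₁C (inj₂ (i , false)) = i , x' i
    end₂C : (Σ (Fin k) λ i → E (G⁻ i)) ⊎ (Fin k × Bool) → Σ (Fin k) λ i → V (G i)
    end₂C (inj₁ (i , a))     = i , end₂ (G⁻ i) a
    end₂C (inj₂ (i , true))  = next i , y (next i)
    end₂C (inj₂ (i , false)) = next i , y' (next i)

  f f' : Fin k → E C
  f i  = inj₂ (i , true)
  f' i = inj₂ (i , false)

  F : EdgeSet C
  F (inj₁ _) = false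
  F (inj₂ _) = true

module Submission where

-- Each G i has a proper r-edge-colouring; the colour class of e i is a perfect matching, so it contains e′ i,
-- hence e i and e′ i share a colour and are disjoint. Recolouring every G i so that this colour becomes a fixed
-- α₀, and giving every f-edge the colour α₀, properly r-colours C, which is r-regular by construction.
-- A perfect matching M of C uses an even number of the four f-edges at each zone (the zone has even order and
-- its internally matched vertices pair up), and never both f-edges of one side and none of the other (otherwise
-- M restricted to the zone, plus e or e′, would be a perfect matching separating e from e′). So if M takes
-- exactly one of f i and f′ i, the side it takes alternates from zone to zone, impossible around an odd cycle:
-- each {f i , f′ i} is equivalent and every perfect matching meets F evenly. F ∼ ∅ would 2-colour the odd cycle
-- of zones, and F ∼ E(C) would 2-colour some G j − e j − e′ j.
-- For 4-connectivity, delete at most three vertices. A zone that lost at most one vertex stays connected even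
-- without e and e′, and consecutive such zones are linked by f-edges, at most one link being broken, so the
-- zones join up around the cycle; a zone that lost two or three vertices still reaches a port whose partner
-- across an f-edge lies outside it and survives.

open import Defs
open import Data.Nat using (ℕ; zero; suc; _+_; _*_; _∸_; _<_; _≤_; _%_; z≤n; s≤s; _<?_; NonZero)
import Data.Nat.Properties as ℕ
open import Data.Nat.Divisibility using (_∣_; divides; ∣m+n∣m⇒∣n; n∣m⇒m%n≡0)
open import Data.Nat.DivMod using (m%n<n; m<n⇒m%n≡m; %-distribˡ-+; m%n%n≡m%n; [m+n]%n≡m%n; m≤n⇒[n∸m]%m≡n%m)
open import Data.Fin using (Fin; zero; suc; toℕ; fromℕ<; punchOut)
import Data.Fin.Properties as Fin
open import Data.Fin.Permutation.Components using (transpose; transpose-inverse)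
open import Data.Bool using (Bool; true; false; not; T; _xor_; _∨_)
import Data.Bool.Properties as Bool
open import Data.Product using (Σ; ∃; _×_; _,_; proj₁; proj₂)
open import Data.Product.Properties using (Σ-≡,≡→≡)
open import Data.Product.Function.NonDependent.Propositional using (_×-↔_)
open import Data.Sum using (_⊎_; inj₁; inj₂; [_,_]′)
open import Data.Sum.Function.Propositional using (_⊎-↔_)
open import Data.List using (List; []; _∷_; length; lookup; map; tabulate)
open import Data.List.Properties using (length-map; length-tabulate)
open import Data.List.Relation.Unary.All as All using (All; []; _∷_)
open import Data.List.Relation.Unary.AllPairs using ([]; _∷_)
open import Data.List.Relation.Unary.Unique.Propositional using (Unique)
open import Data.List.Membership.Propositional using (_∈_; _∉_)
open import Data.List.Membership.Propositional.Properties using (∈-lookup; ∈-map⁺; ∈-tabulate⁺)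
import Data.List.Membership.DecPropositional as DecMembership
open import Data.List.Membership.Setoid.Properties using (index-injective)
open import Data.List.Relation.Unary.Any using (here; there; index)
open import Data.Empty using (⊥; ⊥-elim)
open import Data.Unit using (⊤; tt)
open import Relation.Nullary using (¬_; Dec; yes; no; contradiction)
open import Relation.Nullary.Decidable using (⌊_⌋; decidable-stable; ¬?)
open import Relation.Binary.Definitions using (DecidableEquality; tri<; tri≈; tri>)
open import Relation.Binary.PropositionalEquality
open import Relation.Binary.PropositionalEquality.WithK using (≡-irrelevant)
open import Function.Base using (_∘_; id; case_of_)
open import Function.Bundles using (_↔_; Inverse; mk↔ₛ′)
open import Function.Definitions using (Injective)
open import Function.Properties.Inverse using (↔-sym; ↔-trans)

open Inverse using (to; from)

false≢true : ∀ {b} → b ≡ false → b ≢ true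
false≢true refl ()

xor≡false⇒≡ : ∀ a b → a xor b ≡ false → a ≡ b
xor≡false⇒≡ true true _ = refl
xor≡false⇒≡ false false _ = refl

xor≡true⇒≡not : ∀ a b → a xor b ≡ true → b ≡ not a
xor≡true⇒≡not true false _ = refl
xor≡true⇒≡not false true _ = refl

count : Bool → ℕ
count true = 1
count false = 0

even-count⇒xor≡false : ∀ a b c d → 2 ∣ count a + (count b + (count c + count d)) →
  a xor (b xor (c xor d)) ≡ false
even-count⇒xor≡false a b c d 2∣sum with a xor (b xor (c xor d)) in xor≡
... | false = refl
... | true = contradiction (n∣m⇒m%n≡0 _ 2 2∣sum) (odd a b c d xor≡)
  where
  odd : ∀ a b c d → a xor (b xor (c xor d)) ≡ true → (count a + (count b + (count c + count d))) % 2 ≢ 0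
  odd true true true false _ ()
  odd true true false true _ ()
  odd true false true true _ ()
  odd false true true true _ ()
  odd true false false false _ ()
  odd false true false false _ ()
  odd false false true false _ ()
  odd false false false true _ ()
  odd true true true true () _
  odd true true false false () _
  odd true false true false () _
  odd true false false true () _
  odd false true true false () _
  odd false true false true () _
  odd false false true true () _
  odd false false false false () _

-- Finite cardinalities

module _ {A B : Set} (φ : A ↔ B) where

  to-from : ∀ b → to φ (from φ b) ≡ b
  to-from = Inverse.strictlyInverseˡ φ

  from-to : ∀ a → from φ (to φ a) ≡ a
  from-to = Inverse.strictlyInverseʳ φ

  to-injective : Injective _≡_ _≡_ (to φ)
  to-injective {a} {a'} eq = trans (sym (from-to a)) (trans (cong (from φ) eq) (from-to a'))

  from-injective : Injective _≡_ _≡_ (from φ)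
  from-injective {b} {b'} eq = trans (sym (to-from b)) (trans (cong (to φ) eq) (to-from b'))

size-unique : ∀ {A : Set} {m n} → HasSize A m → HasSize A n → m ≡ n
size-unique φ ψ = ℕ.≤-antisym (Fin.injective⇒≤ (to-injective χ)) (Fin.injective⇒≤ (from-injective χ))
  where χ = ↔-trans φ (↔-sym ψ)

size-⊎ : ∀ {A B : Set} {a b} → HasSize A a → HasSize B b → HasSize (A ⊎ B) (a + b)
size-⊎ φ ψ = ↔-trans Fin.+↔⊎ (φ ⊎-↔ ψ)

size-× : ∀ {A B : Set} {a b} → HasSize A a → HasSize B b → HasSize (A × B) (a * b)
size-× φ ψ = ↔-trans Fin.*↔× (φ ×-↔ ψ)

size1⇒centre : ∀ {A : Set} → HasSize A 1 → Σ A λ a → ∀ b → b ≡ a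
size1⇒centre φ = to φ zero , λ b → trans (sym (to-from φ b)) (cong (to φ) (only-zero (from φ b)))
  where
  only-zero : (i : Fin 1) → i ≡ zero
  only-zero zero = refl

centre⇒size1 : ∀ {A : Set} (a : A) → (∀ b → b ≡ a) → HasSize A 1
centre⇒size1 a centre = mk↔ₛ′ (λ _ → a) (λ _ → zero) (λ b → sym (centre b)) λ { zero → refl }

size-count : ∀ b → HasSize (b ≡ true) (count b)
size-count true = centre⇒size1 refl (λ p → ≡-irrelevant p refl)
size-count false = mk↔ₛ′ (λ ()) (λ ()) (λ ()) (λ ())

size-count² : (B : Bool → Bool → Bool) →
  HasSize (Σ (Bool × Bool) λ st → B (proj₁ st) (proj₂ st) ≡ true)
          (count (B true true) + (count (B true false) + (count (B false true) + count (B false false))))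
size-count² B = ↔-trans
  (size-⊎ (size-count (B true true)) (size-⊎ (size-count (B true false))
    (size-⊎ (size-count (B false true)) (size-count (B false false)))))
  (mk↔ₛ′ join split join-split split-join)
  where
  Cases = (B true true ≡ true) ⊎ ((B true false ≡ true) ⊎ ((B false true ≡ true) ⊎ (B false false ≡ true)))
  join : Cases → Σ (Bool × Bool) λ st → B (proj₁ st) (proj₂ st) ≡ true
  join (inj₁ p) = (true , true) , p
  join (inj₂ (inj₁ p)) = (true , false) , p
  join (inj₂ (inj₂ (inj₁ p))) = (false , true) , p
  join (inj₂ (inj₂ (inj₂ p))) = (false , false) , p
  split : (Σ (Bool × Bool) λ st → B (proj₁ st) (proj₂ st) ≡ true) → Cases
  split ((true , true) , p) = inj₁ p
  split ((true , false) , p) = inj₂ (inj₁ p)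
  split ((false , true) , p) = inj₂ (inj₂ (inj₁ p))
  split ((false , false) , p) = inj₂ (inj₂ (inj₂ p))
  join-split : ∀ z → join (split z) ≡ z
  join-split ((true , true) , p) = refl
  join-split ((true , false) , p) = refl
  join-split ((false , true) , p) = refl
  join-split ((false , false) , p) = refl
  split-join : ∀ z → split (join z) ≡ z
  split-join (inj₁ p) = refl
  split-join (inj₂ (inj₁ p)) = refl
  split-join (inj₂ (inj₂ (inj₁ p))) = refl
  split-join (inj₂ (inj₂ (inj₂ p))) = refl

sumFin : ∀ {k} → (Fin k → ℕ) → ℕ
sumFin {zero} n = 0
sumFin {suc k} n = n zero + sumFin (n ∘ suc)

sumFin-≥ : ∀ {k} (n : Fin k → ℕ) (i : Fin k) → n i ≤ sumFin n
sumFin-≥ n zero = ℕ.m≤m+n _ _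
sumFin-≥ n (suc i) = ℕ.≤-trans (sumFin-≥ (n ∘ suc) i) (ℕ.m≤n+m _ _)

size-Σ : ∀ {k} (F : Fin k → Set) (n : Fin k → ℕ) → (∀ i → HasSize (F i) (n i)) →
  HasSize (Σ (Fin k) F) (sumFin n)
size-Σ {zero} F n φ = mk↔ₛ′ (λ ()) (λ { (() , _) }) (λ { (() , _) }) (λ ())
size-Σ {suc k} F n φ =
  ↔-trans (size-⊎ (φ zero) (size-Σ (F ∘ suc) (n ∘ suc) (φ ∘ suc))) (mk↔ₛ′ join split join-split split-join)
  where
  join : F zero ⊎ Σ (Fin k) (F ∘ suc) → Σ (Fin (suc k)) F
  join (inj₁ a) = zero , a
  join (inj₂ (i , a)) = suc i , a
  split : Σ (Fin (suc k)) F → F zero ⊎ Σ (Fin k) (F ∘ suc)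
  split (zero , a) = inj₁ a
  split (suc i , a) = inj₂ (i , a)
  join-split : ∀ z → join (split z) ≡ z
  join-split (zero , a) = refl
  join-split (suc i , a) = refl
  split-join : ∀ z → split (join z) ≡ z
  split-join (inj₁ a) = refl
  split-join (inj₂ (i , a)) = refl

size-≡ : (a b : Bool) → ∃ λ m → HasSize (a ≡ b) m
size-≡ a b with a Bool.≟ b
... | yes refl = 1 , centre⇒size1 refl (λ p → ≡-irrelevant p refl)
... | no a≢b = 0 , mk↔ₛ′ (λ ()) (λ p → ⊥-elim (a≢b p)) (λ p → ⊥-elim (a≢b p)) (λ ())

size-fibre-Fin : ∀ n (P : Fin n → Bool) b → ∃ λ m → HasSize (Σ (Fin n) λ i → P i ≡ b) m
size-fibre-Fin zero P b = 0 , mk↔ₛ′ (λ ()) (λ { (() , _) }) (λ { (() , _) }) (λ ())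
size-fibre-Fin (suc n) P b with size-≡ (P zero) b | size-fibre-Fin n (P ∘ suc) b
... | m₀ , φ₀ | m , ψ = m₀ + m , ↔-trans (size-⊎ φ₀ ψ) (mk↔ₛ′ join split join-split split-join)
  where
  join : (P zero ≡ b) ⊎ (Σ (Fin n) λ i → P (suc i) ≡ b) → Σ (Fin (suc n)) λ i → P i ≡ b
  join (inj₁ p) = zero , p
  join (inj₂ (i , p)) = suc i , p
  split : (Σ (Fin (suc n)) λ i → P i ≡ b) → (P zero ≡ b) ⊎ (Σ (Fin n) λ i → P (suc i) ≡ b)
  split (zero , p) = inj₁ p
  split (suc i , p) = inj₂ (i , p)
  join-split : ∀ z → join (split z) ≡ z
  join-split (zero , p) = refl
  join-split (suc i , p) = refl
  split-join : ∀ z → split (join z) ≡ z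
  split-join (inj₁ p) = refl
  split-join (inj₂ (i , p)) = refl

size-fibre : ∀ {A : Set} {n} → HasSize A n → (P : A → Bool) → ∀ b → ∃ λ m → HasSize (Σ A λ a → P a ≡ b) m
size-fibre {A} {n} φ P b with size-fibre-Fin n (P ∘ to φ) b
... | m , ψ = m , ↔-trans ψ (mk↔ₛ′ forth back forth-back back-forth)
  where
  forth : (Σ (Fin n) λ i → P (to φ i) ≡ b) → Σ A λ a → P a ≡ b
  forth (i , p) = to φ i , p
  back : (Σ A λ a → P a ≡ b) → Σ (Fin n) λ i → P (to φ i) ≡ b
  back (a , p) = from φ a , subst (λ z → P z ≡ b) (sym (to-from φ a)) p
  forth-back : ∀ z → forth (back z) ≡ z
  forth-back (a , p) = Σ-≡,≡→≡ (to-from φ a , ≡-irrelevant _ _)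
  back-forth : ∀ z → back (forth z) ≡ z
  back-forth (i , p) = Σ-≡,≡→≡ (from-to φ i , ≡-irrelevant _ _)

fibres : ∀ {A : Set} (P : A → Bool) → A ↔ ((Σ A λ a → P a ≡ true) ⊎ (Σ A λ a → P a ≡ false))
fibres {A} P = mk↔ₛ′ (λ a → classify a (P a) refl) forget forget-classify classify-forget
  where
  classify : ∀ a b → P a ≡ b → (Σ A λ a → P a ≡ true) ⊎ (Σ A λ a → P a ≡ false)
  classify a true p = inj₁ (a , p)
  classify a false p = inj₂ (a , p)
  forget : (Σ A λ a → P a ≡ true) ⊎ (Σ A λ a → P a ≡ false) → A
  forget (inj₁ (a , _)) = a
  forget (inj₂ (a , _)) = a
  forget-classify : ∀ z → classify (forget z) (P (forget z)) refl ≡ z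
  forget-classify (inj₁ (a , p)) = helper (P a) refl
    where
    helper : ∀ b (q : P a ≡ b) → classify a b q ≡ inj₁ (a , p)
    helper true q = cong (λ z → inj₁ (a , z)) (≡-irrelevant q p)
    helper false q = ⊥-elim (false≢true q p)
  forget-classify (inj₂ (a , p)) = helper (P a) refl
    where
    helper : ∀ b (q : P a ≡ b) → classify a b q ≡ inj₂ (a , p)
    helper true q = ⊥-elim (false≢true p q)
    helper false q = cong (λ z → inj₂ (a , z)) (≡-irrelevant q p)
  classify-forget : ∀ a → forget (classify a (P a) refl) ≡ a
  classify-forget a = helper (P a) refl
    where
    helper : ∀ b (q : P a ≡ b) → forget (classify a b q) ≡ a
    helper true q = refl
    helper false q = refl

size-fibres : ∀ {A : Set} {n} → HasSize A n → (P : A → Bool) →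
  ∃ λ m₁ → ∃ λ m₂ → HasSize (Σ A λ a → P a ≡ true) m₁ × HasSize (Σ A λ a → P a ≡ false) m₂ × n ≡ m₁ + m₂
size-fibres φ P with size-fibre φ P true | size-fibre φ P false
... | m₁ , ψ₁ | m₂ , ψ₂ = m₁ , m₂ , ψ₁ , ψ₂ , size-unique φ (↔-trans (size-⊎ ψ₁ ψ₂) (↔-sym (fibres P)))

module _ {A : Set} {n} (φ : HasSize A n) (σ : A → A)
  (σ-involutive : ∀ a → σ (σ a) ≡ a) (σ-fixpoint-free : ∀ a → σ a ≢ a) where

  private
    -- a leads its pair {a , σ a} when its index is the smaller one
    leading : A → Bool
    leading a = ⌊ from φ a Fin.<? from φ (σ a) ⌋

    leading-σ : ∀ a → leading (σ a) ≡ not (leading a)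
    leading-σ a with from φ a Fin.<? from φ (σ a) | from φ (σ a) Fin.<? from φ (σ (σ a))
    ... | yes a<σa | yes σa<a = ⊥-elim (Fin.<-asym a<σa (subst (λ z → toℕ (from φ (σ a)) < toℕ (from φ z)) (σ-involutive a) σa<a))
    ... | yes _ | no _ = refl
    ... | no _ | yes _ = refl
    ... | no a≮σa | no σa≮a with Fin.<-cmp (from φ a) (from φ (σ a))
    ...   | tri< a<σa _ _ = ⊥-elim (a≮σa a<σa)
    ...   | tri≈ _ a≡σa _ = ⊥-elim (σ-fixpoint-free a (sym (from-injective φ a≡σa)))
    ...   | tri> _ _ σa<a = ⊥-elim (σa≮a (subst (λ z → toℕ (from φ (σ a)) < toℕ (from φ z)) (sym (σ-involutive a)) σa<a))

    Leading : Set
    Leading = Σ A λ a → leading a ≡ true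

    choose : ∀ a b → leading a ≡ b → Leading × Bool
    choose a true p = (a , p) , true
    choose a false p = (σ a , trans (leading-σ a) (cong not p)) , false

    unchoose : Leading × Bool → A
    unchoose ((a , _) , true) = a
    unchoose ((a , _) , false) = σ a

    unchoose-choose : ∀ a b p → unchoose (choose a b p) ≡ a
    unchoose-choose a true p = refl
    unchoose-choose a false p = σ-involutive a

    choose-unchoose : ∀ z → choose (unchoose z) (leading (unchoose z)) refl ≡ z
    choose-unchoose ((a , p) , true) = helper (leading a) refl
      where
      helper : ∀ b (q : leading a ≡ b) → choose a b q ≡ ((a , p) , true)
      helper true q = cong (λ z → (a , z) , true) (≡-irrelevant q p)
      helper false q = ⊥-elim (false≢true q p)
    choose-unchoose ((a , p) , false) = helper (leading (σ a)) refl
      where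
      helper : ∀ b (q : leading (σ a) ≡ b) → choose (σ a) b q ≡ ((a , p) , false)
      helper true q = ⊥-elim (false≢true (trans (leading-σ a) (cong not p)) q)
      helper false q = cong (_, false) (Σ-≡,≡→≡ (σ-involutive a , ≡-irrelevant _ _))

  involution⇒even : 2 ∣ n
  involution⇒even with size-fibre φ leading true
  ... | m , ψ = divides m (size-unique φ (↔-trans (size-× ψ Fin.2↔Bool)
                  (mk↔ₛ′ unchoose (λ a → choose a (leading a) refl) (λ a → unchoose-choose a _ refl) choose-unchoose)))

injective⇒surjective : ∀ {n} (h : Fin n → Fin n) → Injective _≡_ _≡_ h → ∀ α → ∃ λ j → h j ≡ α
injective⇒surjective {zero} h inj ()
injective⇒surjective {suc m} h inj α with Fin.any? (λ j → h j Fin.≟ α)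
... | yes hit = hit
... | no miss = ⊥-elim (ℕ.<-irrefl refl (Fin.injective⇒≤ h′-injective))
  where
  h′ : Fin (suc m) → Fin m
  h′ j = punchOut {i = α} {j = h j} (λ eq → miss (j , sym eq))
  h′-injective : Injective _≡_ _≡_ h′
  h′-injective {a} {b} eq = inj (Fin.punchOut-injective (λ e → miss (a , sym e)) (λ e → miss (b , sym e)) eq)

-- Lists and pigeonholes

Within : ∀ {A : Set} → (A → Bool) → List A → Set
Within S zs = ∀ v → S v ≡ true → v ∈ zs

module _ {A : Set} (_≟_ : DecidableEquality A) where
  open DecMembership _≟_ using (_∈?_)

  injection-escapes : ∀ {n} (xs : List A) (f : Fin n → A) → Injective _≡_ _≡_ f → length xs < n →
    ∃ λ t → f t ∉ xs
  injection-escapes xs f f-injective xs<n with Fin.any? (λ t → ¬? (f t ∈? xs))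
  ... | yes escape = escape
  ... | no none = ⊥-elim (ℕ.<⇒≱ xs<n (Fin.injective⇒≤ index-injective′))
    where
    inside : ∀ t → f t ∈ xs
    inside t = decidable-stable (f t ∈? xs) (λ t∉ → none (t , t∉))
    index-injective′ : Injective _≡_ _≡_ (λ t → index (inside t))
    index-injective′ eq = f-injective (index-injective (setoid A) (inside _) (inside _) eq)

  within⇒size≤ : ∀ {S : A → Bool} {zs m} → HasSize (Σ A λ a → S a ≡ true) m → Within S zs → m ≤ length zs
  within⇒size≤ {zs = zs} ψ within = ℕ.≮⇒≥ λ zs<m →
    let (t , t∉zs) = injection-escapes zs (proj₁ ∘ to ψ) element-injective zs<m
    in t∉zs (within _ (proj₂ (to ψ t)))
    where
    element-injective : Injective _≡_ _≡_ (proj₁ ∘ to ψ)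
    element-injective eq = to-injective ψ (Σ-≡,≡→≡ (eq , ≡-irrelevant _ _))

  lookup-injective : ∀ {xs : List A} → Unique xs → Injective _≡_ _≡_ (lookup xs)
  lookup-injective {x ∷ xs} (x∉ ∷ u) {zero} {zero} _ = refl
  lookup-injective {x ∷ xs} (x∉ ∷ u) {zero} {suc j} eq = ⊥-elim (All.lookup x∉ (∈-lookup j) eq)
  lookup-injective {x ∷ xs} (x∉ ∷ u) {suc i} {zero} eq = ⊥-elim (All.lookup x∉ (∈-lookup i) (sym eq))
  lookup-injective {x ∷ xs} (x∉ ∷ u) {suc i} {suc j} eq = cong suc (lookup-injective u eq)

  unique-within⇒length≤ : ∀ {xs zs : List A} → Unique xs → All (_∈ zs) xs → length xs ≤ length zs
  unique-within⇒length≤ {xs} {zs} u xs⊆zs = ℕ.≮⇒≥ λ zs<xs →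
    let (t , t∉zs) = injection-escapes zs (lookup xs) (lookup-injective u) zs<xs
    in t∉zs (All.lookup xs⊆zs (∈-lookup t))

  insert : (A → Bool) → A → A → Bool
  insert S a w = S w ∨ ⌊ w ≟ a ⌋

  insert-within : ∀ S {zs} a → Within S zs → Within (insert S a) (a ∷ zs)
  insert-within S a within w p with S w in Sw | w ≟ a
  ... | true | _ = there (within w Sw)
  ... | false | yes w≡a = here w≡a

  insert-∌ : ∀ S {a w} → S w ≡ false → w ≢ a → insert S a w ≡ false
  insert-∌ S {a} {w} Sw w≢a rewrite Sw with w ≟ a
  ... | yes w≡a = ⊥-elim (w≢a w≡a)
  ... | no _ = refl

  insert-∌⁻ : ∀ S {a w} → insert S a w ≡ false → S w ≡ false × w ≢ a
  insert-∌⁻ S {a} {w} p with S w | w ≟ a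
  ... | false | no w≢a = refl , w≢a

  insert-∋ : ∀ S a → insert S a a ≡ true
  insert-∋ S a with S a | a ≟ a
  ... | true | _ = refl
  ... | false | yes _ = refl
  ... | false | no a≢a = ⊥-elim (a≢a refl)

  insert-mono : ∀ S {a w} → S w ≡ true → insert S a w ≡ true
  insert-mono S Sw rewrite Sw = refl

∈-length≤1 : ∀ {A : Set} {ys : List A} {u v} → length ys ≤ 1 → u ∈ ys → v ∈ ys → u ≡ v
∈-length≤1 {ys = _ ∷ []} _ (here refl) (here refl) = refl
∈-length≤1 {ys = _ ∷ _ ∷ _} (s≤s ()) _ _

transpose-matchˡ : ∀ {n} (i j : Fin n) → transpose i j i ≡ j
transpose-matchˡ i j with i Fin.≟ i
... | yes _ = refl
... | no i≢i = ⊥-elim (i≢i refl)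

transpose-injective : ∀ {n} (i j : Fin n) → Injective _≡_ _≡_ (transpose i j)
transpose-injective i j {a} {b} eq =
  trans (sym (transpose-inverse j i)) (trans (cong (transpose j i) eq) (transpose-inverse j i))

-- The cyclic order on Fin k

next^ : ∀ {k} → ℕ → Fin k → Fin k
next^ zero i = i
next^ (suc t) i = next (next^ t i)

private
  [m+n%d]%d≡[m+n]%d : ∀ m n d .{{_ : NonZero d}} → (m + n % d) % d ≡ (m + n) % d
  [m+n%d]%d≡[m+n]%d m n d = begin
      (m + n % d) % d            ≡⟨ %-distribˡ-+ m (n % d) d ⟩
      (m % d + n % d % d) % d    ≡⟨ cong (λ z → (m % d + z) % d) (m%n%n≡m%n n d) ⟩
      (m % d + n % d) % d        ≡⟨ %-distribˡ-+ m n d ⟨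
      (m + n) % d                ∎
    where open ≡-Reasoning

toℕ-next : ∀ {n} (i : Fin (suc n)) → toℕ (next i) ≡ suc (toℕ i) % suc n
toℕ-next i = Fin.toℕ-fromℕ< _

toℕ-next^ : ∀ {n} t (i : Fin (suc n)) → toℕ (next^ t i) ≡ (toℕ i + t) % suc n
toℕ-next^ {n} zero i = trans (sym (m<n⇒m%n≡m (Fin.toℕ<n i))) (cong (_% suc n) (sym (ℕ.+-identityʳ (toℕ i))))
toℕ-next^ {n} (suc t) i = begin
    toℕ (next (next^ t i))               ≡⟨ toℕ-next (next^ t i) ⟩
    suc (toℕ (next^ t i)) % suc n        ≡⟨ cong (λ z → suc z % suc n) (toℕ-next^ t i) ⟩
    (1 + (toℕ i + t) % suc n) % suc n    ≡⟨ [m+n%d]%d≡[m+n]%d 1 (toℕ i + t) (suc n) ⟩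
    suc (toℕ i + t) % suc n              ≡⟨ cong (_% suc n) (ℕ.+-suc (toℕ i) t) ⟨
    (toℕ i + suc t) % suc n              ∎
  where open ≡-Reasoning

next^-k : ∀ {k} (i : Fin k) → next^ k i ≡ i
next^-k {suc n} i = Fin.toℕ-injective (trans (toℕ-next^ (suc n) i)
  (trans ([m+n]%n≡m%n (toℕ i) (suc n)) (m<n⇒m%n≡m (Fin.toℕ<n i))))

next^-next : ∀ {k} t (j : Fin k) → next^ t (next j) ≡ next (next^ t j)
next^-next zero j = refl
next^-next (suc t) j = cong next (next^-next t j)

prev : ∀ {k} → Fin k → Fin k
prev {suc n} = next^ n

next-prev : ∀ {k} (i : Fin k) → next (prev i) ≡ i
next-prev {suc n} = next^-k

prev-next : ∀ {k} (i : Fin k) → prev (next i) ≡ i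
prev-next {suc n} i = trans (next^-next n i) (next^-k i)

next-injective : ∀ {k} {i j : Fin k} → next i ≡ next j → i ≡ j
next-injective {i = i} {j} eq = trans (sym (prev-next i)) (trans (cong prev eq) (prev-next j))

next^-reaches : ∀ {k} (i j : Fin k) → ∃ λ t → t < k × next^ t i ≡ j
next^-reaches {suc n} i j = t , m%n<n (toℕ j + (suc n ∸ toℕ i)) (suc n) , Fin.toℕ-injective (begin
    toℕ (next^ t i)                              ≡⟨ toℕ-next^ t i ⟩
    (toℕ i + t) % suc n                          ≡⟨ [m+n%d]%d≡[m+n]%d (toℕ i) (toℕ j + (suc n ∸ toℕ i)) (suc n) ⟩
    (toℕ i + (toℕ j + (suc n ∸ toℕ i))) % suc n  ≡⟨ cong (_% suc n) shuffle ⟩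
    (toℕ j + suc n) % suc n                      ≡⟨ [m+n]%n≡m%n (toℕ j) (suc n) ⟩
    toℕ j % suc n                                ≡⟨ m<n⇒m%n≡m (Fin.toℕ<n j) ⟩
    toℕ j                                        ∎)
  where
  open ≡-Reasoning
  t = (toℕ j + (suc n ∸ toℕ i)) % suc n
  shuffle : toℕ i + (toℕ j + (suc n ∸ toℕ i)) ≡ toℕ j + suc n
  shuffle = begin
    toℕ i + (toℕ j + (suc n ∸ toℕ i)) ≡⟨ ℕ.+-assoc (toℕ i) (toℕ j) _ ⟨
    toℕ i + toℕ j + (suc n ∸ toℕ i)   ≡⟨ cong (_+ (suc n ∸ toℕ i)) (ℕ.+-comm (toℕ i) (toℕ j)) ⟩
    toℕ j + toℕ i + (suc n ∸ toℕ i)   ≡⟨ ℕ.+-assoc (toℕ j) (toℕ i) _ ⟩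
    toℕ j + (toℕ i + (suc n ∸ toℕ i)) ≡⟨ cong (toℕ j +_) (ℕ.m+[n∸m]≡n (ℕ.<⇒≤ (Fin.toℕ<n i))) ⟩
    toℕ j + suc n                     ∎

next^-moves : ∀ {k} t (i : Fin k) → 0 < t → t < k → next^ t i ≢ i
next^-moves {suc n} t i 0<t t<k eq with toℕ i + t <? suc n
... | yes no-wrap = ℕ.<-irrefl (sym (ℕ.+-cancelˡ-≡ (toℕ i) t 0 (begin
    toℕ i + t             ≡⟨ m<n⇒m%n≡m no-wrap ⟨
    (toℕ i + t) % suc n   ≡⟨ returns ⟩
    toℕ i                 ≡⟨ ℕ.+-identityʳ (toℕ i) ⟨
    toℕ i + 0             ∎))) 0<t
  where
  open ≡-Reasoning
  returns : (toℕ i + t) % suc n ≡ toℕ i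
  returns = trans (sym (toℕ-next^ t i)) (cong toℕ eq)
... | no wrap = ℕ.<-irrefl (sym (ℕ.+-cancelˡ-≡ (toℕ i) (suc n) t (begin
    toℕ i + suc n                 ≡⟨ cong (_+ suc n) reduced ⟨
    (toℕ i + t ∸ suc n) + suc n   ≡⟨ ℕ.m∸n+n≡m k≤ ⟩
    toℕ i + t                     ∎))) t<k
  where
  open ≡-Reasoning
  k≤ : suc n ≤ toℕ i + t
  k≤ = ℕ.≮⇒≥ wrap
  small : toℕ i + t ∸ suc n < suc n
  small = ℕ.≤-<-trans (ℕ.∸-monoˡ-≤ (suc n) (ℕ.+-monoʳ-≤ (toℕ i) (ℕ.<⇒≤ t<k)))
            (subst (_< suc n) (sym (ℕ.m+n∸n≡m (toℕ i) (suc n))) (Fin.toℕ<n i))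
  reduced : toℕ i + t ∸ suc n ≡ toℕ i
  reduced = begin
    toℕ i + t ∸ suc n               ≡⟨ m<n⇒m%n≡m small ⟨
    (toℕ i + t ∸ suc n) % suc n     ≡⟨ m≤n⇒[n∸m]%m≡n%m k≤ ⟩
    (toℕ i + t) % suc n             ≡⟨ toℕ-next^ t i ⟨
    toℕ (next^ t i)                 ≡⟨ cong toℕ eq ⟩
    toℕ i                           ∎

next-moves : ∀ {k} → 2 ≤ k → (i : Fin k) → next i ≢ i
next-moves 2≤k i = next^-moves 1 i (s≤s z≤n) 2≤k

prev-moves : ∀ {k} → 2 ≤ k → (i : Fin k) → prev i ≢ i
prev-moves 2≤k i eq = next-moves 2≤k i (trans (cong next (sym eq)) (next-prev i))

next≢prev : ∀ {k} → 3 ≤ k → (i : Fin k) → next i ≢ prev i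
next≢prev 3≤k i eq = next^-moves 2 i (s≤s z≤n) 3≤k (trans (cong next eq) (next-prev i))

odd-cycle-no-alternation : ∀ {k} → k % 2 ≡ 1 → (P : Fin k → Set) (c : Fin k → Bool) →
  (∀ i → P i → P (next i)) → (∀ i → P i → c (next i) ≡ not (c i)) → ∀ i → ¬ P i
odd-cycle-no-alternation {k} k-odd P c P-next flips i p =
  Bool.not-¬ refl (trans (sym (cong c (next^-k i))) (trans (labels k) (odd-flips k k-odd)))
  where
  flip^ : ℕ → Bool → Bool
  flip^ zero b = b
  flip^ (suc t) b = not (flip^ t b)
  odd-flips : ∀ t → t % 2 ≡ 1 → flip^ t (c i) ≡ not (c i)
  odd-flips (suc zero) _ = refl
  odd-flips (suc (suc t)) t-odd = trans (Bool.not-involutive _) (odd-flips t t-odd)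
  P^ : ∀ t → P (next^ t i)
  P^ zero = p
  P^ (suc t) = P-next _ (P^ t)
  labels : ∀ t → c (next^ t i) ≡ flip^ t (c i)
  labels zero = refl
  labels (suc t) = trans (flips _ (P^ t)) (cong not (labels t))

module _ (H : Graph) where

  Adj-sym : ∀ {g u v} → Adj H g u v → Adj H g v u
  Adj-sym (inj₁ (p , q)) = inj₂ (q , p)
  Adj-sym (inj₂ (p , q)) = inj₁ (q , p)

  Adj⇒Inc₁ : ∀ {g u v} → Adj H g u v → Inc H u g
  Adj⇒Inc₁ (inj₁ (p , _)) = inj₁ p
  Adj⇒Inc₁ (inj₂ (p , _)) = inj₂ p

  Adj⇒Inc₂ : ∀ {g u v} → Adj H g u v → Inc H v g
  Adj⇒Inc₂ (inj₁ (_ , q)) = inj₂ q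
  Adj⇒Inc₂ (inj₂ (_ , q)) = inj₁ q

  Adj-ends : ∀ {g u v w} → Adj H g u v → Inc H w g → (w ≡ u) ⊎ (w ≡ v)
  Adj-ends (inj₁ (p , q)) (inj₁ r) = inj₁ (trans (sym r) p)
  Adj-ends (inj₁ (p , q)) (inj₂ r) = inj₂ (trans (sym r) q)
  Adj-ends (inj₂ (p , q)) (inj₁ r) = inj₂ (trans (sym r) q)
  Adj-ends (inj₂ (p , q)) (inj₂ r) = inj₁ (trans (sym r) p)

  Inc⇒endAt : ∀ {g v} → Inc H v g → Σ Bool λ b → endAt H g b ≡ v
  Inc⇒endAt (inj₁ p) = true , p
  Inc⇒endAt (inj₂ p) = false , p

  endAt⇒Inc : ∀ {g v} b → endAt H g b ≡ v → Inc H v g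
  endAt⇒Inc true p = inj₁ p
  endAt⇒Inc false p = inj₂ p

  incidence⇒Inc : ∀ {v} (a : Incidences H v) → Inc H v (proj₁ a)
  incidence⇒Inc (g , b , p) = endAt⇒Inc b p

  pair-≡ˡ : ∀ a b → pair H a b a ≡ true
  pair-≡ˡ a b with _≟E_ H a a
  ... | yes _ = refl
  ... | no a≢a = ⊥-elim (a≢a refl)

  pair-≡ʳ : ∀ a b → pair H a b b ≡ true
  pair-≡ʳ a b with _≟E_ H b a | _≟E_ H b b
  ... | yes _ | _ = refl
  ... | no _ | yes _ = refl
  ... | no _ | no b≢b = ⊥-elim (b≢b refl)

  pair-≢ : ∀ a b z → z ≢ a → z ≢ b → pair H a b z ≡ false
  pair-≢ a b z z≢a z≢b with _≟E_ H z a | _≟E_ H z b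
  ... | yes z≡a | _ = ⊥-elim (z≢a z≡a)
  ... | no _ | yes z≡b = ⊥-elim (z≢b z≡b)
  ... | no _ | no _ = refl

  pair-cases : ∀ a b z → pair H a b z ≡ true → (z ≡ a) ⊎ (z ≡ b)
  pair-cases a b z p with _≟E_ H z a | _≟E_ H z b
  ... | yes z≡a | _ = inj₁ z≡a
  ... | no _ | yes z≡b = inj₂ z≡b
  ... | no _ | no _ = ⊥-elim (false≢true refl p)

  WalkAvoiding-start : ∀ {S u v} → WalkAvoiding H S u v → S u ≡ false
  WalkAvoiding-start (stay p) = p
  WalkAvoiding-start (step _ p _ _) = p

  WalkAvoiding-end : ∀ {S u v} → WalkAvoiding H S u v → S v ≡ false
  WalkAvoiding-end (stay p) = p
  WalkAvoiding-end (step _ _ _ w) = WalkAvoiding-end w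

  WalkAvoiding-trans : ∀ {S u v w} → WalkAvoiding H S u v → WalkAvoiding H S v w → WalkAvoiding H S u w
  WalkAvoiding-trans (stay _) w₂ = w₂
  WalkAvoiding-trans (step g p a w₁) w₂ = step g p a (WalkAvoiding-trans w₁ w₂)

  WalkAvoiding-sym : ∀ {S u v} → WalkAvoiding H S u v → WalkAvoiding H S v u
  WalkAvoiding-sym (stay p) = stay p
  WalkAvoiding-sym (step g p a w) =
    WalkAvoiding-trans (WalkAvoiding-sym w) (step g (WalkAvoiding-start w) (Adj-sym a) (stay p))

  WalkAvoiding-mono : ∀ {S S′ u v} → (∀ z → S z ≡ false → S′ z ≡ false) → WalkAvoiding H S u v → WalkAvoiding H S′ u v
  WalkAvoiding-mono S′⊆S (stay p) = stay (S′⊆S _ p)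
  WalkAvoiding-mono S′⊆S (step g p a w) = step g (S′⊆S _ p) a (WalkAvoiding-mono S′⊆S w)

WalkAvoiding-map : ∀ {H H′ : Graph} (fv : V H → V H′) {S : V H → Bool} {S′ : V H′ → Bool} →
  (∀ z → S z ≡ false → S′ (fv z) ≡ false) →
  (∀ {g u v} → Adj H g u v → S u ≡ false → S v ≡ false → Σ (E H′) λ g′ → Adj H′ g′ (fv u) (fv v)) →
  ∀ {u v} → WalkAvoiding H S u v → WalkAvoiding H′ S′ (fv u) (fv v)
WalkAvoiding-map fv hS fe (stay p) = stay (hS _ p)
WalkAvoiding-map {H} fv hS fe (step g p a w) =
  step (proj₁ edge) (hS _ p) (proj₂ edge) (WalkAvoiding-map fv hS fe w)
  where edge = fe a p (WalkAvoiding-start H w)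

module _ (H : Graph) (loopless : Loopless H) where

  Adj⇒≢ : ∀ {g u v} → Adj H g u v → u ≢ v
  Adj⇒≢ (inj₁ (p , q)) u≡v = loopless _ (trans p (trans u≡v (sym q)))
  Adj⇒≢ (inj₂ (p , q)) u≡v = loopless _ (sym (trans p (trans u≡v (sym q))))

  Adj-other-end : ∀ {g u w v} b → Adj H g u w → endAt H g b ≡ v → v ≢ u → v ≡ w
  Adj-other-end true (inj₁ (p , q)) s v≢u = ⊥-elim (v≢u (trans (sym s) p))
  Adj-other-end true (inj₂ (p , q)) s v≢u = trans (sym s) q
  Adj-other-end false (inj₁ (p , q)) s v≢u = trans (sym s) q
  Adj-other-end false (inj₂ (p , q)) s v≢u = ⊥-elim (v≢u (trans (sym s) p))

  Inc-irrelevant : ∀ {v g} (p q : Inc H v g) → p ≡ q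
  Inc-irrelevant (inj₁ p) (inj₁ q) = cong inj₁ (≡-irrelevant p q)
  Inc-irrelevant (inj₂ p) (inj₂ q) = cong inj₂ (≡-irrelevant p q)
  Inc-irrelevant (inj₁ p) (inj₂ q) = ⊥-elim (loopless _ (trans p (sym q)))
  Inc-irrelevant (inj₂ p) (inj₁ q) = ⊥-elim (loopless _ (trans q (sym p)))

  incidence-injective : ∀ {v} (a b : Incidences H v) → proj₁ a ≡ proj₁ b → a ≡ b
  incidence-injective (g , true , p) (.g , true , q) refl = cong (λ z → g , true , z) (≡-irrelevant p q)
  incidence-injective (g , false , p) (.g , false , q) refl = cong (λ z → g , false , z) (≡-irrelevant p q)
  incidence-injective (g , true , p) (.g , false , q) refl = ⊥-elim (loopless g (trans p (sym q)))
  incidence-injective (g , false , p) (.g , true , q) refl = ⊥-elim (loopless g (trans q (sym p)))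

  UniqueAt : V H → EdgeSet H → Set
  UniqueAt v M = Σ (E H) λ g → (M g ≡ true × Inc H v g) × (∀ g′ → M g′ ≡ true → Inc H v g′ → g′ ≡ g)

  perfect⇒uniqueAt : ∀ {M} → PerfectMatching H M → ∀ v → UniqueAt v M
  perfect⇒uniqueAt pm v with size1⇒centre (pm v)
  ... | (g , p) , centre = g , p , λ g′ m i → cong proj₁ (centre (g′ , m , i))

  uniqueAt⇒perfect : ∀ M → (∀ v → UniqueAt v M) → PerfectMatching H M
  uniqueAt⇒perfect M unique v with unique v
  ... | g , p , only = centre⇒size1 (g , p) λ { (g′ , m , i) → same g′ m i (only g′ m i) }
    where
    same : ∀ g′ m i → g′ ≡ g → (g′ , m , i) ≡ (g , p)
    same g′ m i refl = cong (g ,_) (cong₂ _,_ (≡-irrelevant _ _) (Inc-irrelevant _ _))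

  colours-at-injective : ∀ {v d j} (c : E H → Fin j) (φ : Degree H v d) → ProperEdgeColouring H j c →
    Injective _≡_ _≡_ (λ t → c (proj₁ (to φ t)))
  colours-at-injective {v} c φ proper {a} {b} eq with _≟E_ H (proj₁ (to φ a)) (proj₁ (to φ b))
  ... | yes same = to-injective φ (incidence-injective _ _ same)
  ... | no differ = ⊥-elim (proper _ _ differ (v , incidence⇒Inc H (to φ a) , incidence⇒Inc H (to φ b)) eq)

  degree≤colours : ∀ {v d j} (c : E H → Fin j) → Degree H v d → ProperEdgeColouring H j c → d ≤ j
  degree≤colours c φ proper = Fin.injective⇒≤ (colours-at-injective c φ proper)

  module ColourClasses {r} (regular : Regular H r) (c : E H → Fin r) (proper : ProperEdgeColouring H r c) where

    colour-at : ∀ v α → Σ (E H) λ g → c g ≡ α × Inc H v g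
    colour-at v α with injective⇒surjective _ (colours-at-injective c (regular v) proper) α
    ... | j , p = proj₁ (to (regular v) j) , p , incidence⇒Inc H (to (regular v) j)

    class : Fin r → EdgeSet H
    class α g = ⌊ c g Fin.≟ α ⌋

    class-≡ : ∀ {α g} → c g ≡ α → class α g ≡ true
    class-≡ {α} {g} p with c g Fin.≟ α
    ... | yes _ = refl
    ... | no q = ⊥-elim (q p)

    ≡-class : ∀ {α g} → class α g ≡ true → c g ≡ α
    ≡-class {α} {g} p with c g Fin.≟ α
    ... | yes q = q
    ... | no _ = ⊥-elim (false≢true refl p)

    class-perfect : ∀ α → PerfectMatching H (class α)
    class-perfect α = uniqueAt⇒perfect (class α) λ v → let (g , p , i) = colour-at v α in
      g , (class-≡ p , i) , λ g′ m i′ → same-colour v (trans (≡-class m) (sym p)) i′ i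
      where
      same-colour : ∀ v {g g′} → c g ≡ c g′ → Inc H v g → Inc H v g′ → g ≡ g′
      same-colour v {g} {g′} eq i i′ with _≟E_ H g g′
      ... | yes q = q
      ... | no q = ⊥-elim (proper g g′ q (v , i , i′) eq)

  other-end : ∀ {v} g → Inc H v g → V H
  other-end g (inj₁ _) = end₂ H g
  other-end g (inj₂ _) = end₁ H g

  module Mates (M : EdgeSet H) (perfect : PerfectMatching H M) where

    edge : V H → E H
    edge v = proj₁ (perfect⇒uniqueAt perfect v)

    edge-∈ : ∀ v → M (edge v) ≡ true
    edge-∈ v = proj₁ (proj₁ (proj₂ (perfect⇒uniqueAt perfect v)))

    edge-Inc : ∀ v → Inc H v (edge v)
    edge-Inc v = proj₂ (proj₁ (proj₂ (perfect⇒uniqueAt perfect v)))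

    edge-unique : ∀ v g → M g ≡ true → Inc H v g → g ≡ edge v
    edge-unique v = proj₂ (proj₂ (perfect⇒uniqueAt perfect v))

    mate : V H → V H
    mate v = other-end (edge v) (edge-Inc v)

    mate-Inc : ∀ v → Inc H (mate v) (edge v)
    mate-Inc v with edge-Inc v
    ... | inj₁ _ = inj₂ refl
    ... | inj₂ _ = inj₁ refl

    mate-≢ : ∀ v → mate v ≢ v
    mate-≢ v with edge-Inc v
    ... | inj₁ p = λ q → loopless _ (trans p (sym q))
    ... | inj₂ p = λ q → loopless _ (trans q (sym p))

    edge-mate : ∀ v → edge (mate v) ≡ edge v
    edge-mate v = sym (edge-unique (mate v) (edge v) (edge-∈ v) (mate-Inc v))

    mate-involutive : ∀ v → mate (mate v) ≡ v
    mate-involutive v = back (edge (mate v)) (edge-mate v) (edge-Inc (mate v))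
      where
      back : ∀ g → g ≡ edge v → (j : Inc H (mate v) g) → other-end g j ≡ v
      back g refl j with edge-Inc v | j
      ... | inj₁ p | inj₁ q = ⊥-elim (loopless g q)
      ... | inj₁ p | inj₂ q = p
      ... | inj₂ p | inj₁ q = p
      ... | inj₂ p | inj₂ q = ⊥-elim (loopless g (sym q))

    order-even : ∀ {n} → HasSize (V H) n → 2 ∣ n
    order-even φ = involution⇒even φ mate mate-involutive mate-≢

module _ (H : Graph) where

  avoided-vertex-blocks : ∀ {S : V H → Bool} {c d} → S c ≡ true → Inc H c d →
    ∀ {g a b} → Adj H g a b → S a ≡ false → S b ≡ false → g ≢ d
  avoided-vertex-blocks Sc c∈d a-b Sa Sb refl with Adj-ends H a-b c∈d
  ... | inj₁ refl = false≢true Sa Sc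
  ... | inj₂ refl = false≢true Sb Sc

  WalkAvoiding-delete : ∀ {S : V H → Bool} (D : EdgeSet H) →
    (∀ {g a b} → Adj H g a b → S a ≡ false → S b ≡ false → D g ≡ false) →
    ∀ {u v} → WalkAvoiding H S u v → WalkAvoiding (deleteEdges H D) S u v
  WalkAvoiding-delete D kept = WalkAvoiding-map id (λ _ p → p)
    (λ {g} a-b Sa Sb → (g , subst (T ∘ not) (sym (kept a-b Sa Sb)) tt) , a-b)

-- An equivalent pair and its deletion

module EquivalentPair (H : Graph) (loopless : Loopless H) {r} (regular : Regular H r) (class1 : Class1 H)
  (e e′ : E H) (e≢e′ : e ≢ e′) (equivalent : EquivalentSet H (pair H e e′)) where

  colourable : EdgeColourable H r
  colourable = let (k , (k-colourable , _) , (_ , v , degree-k)) = class1 in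
    subst (EdgeColourable H) (size-unique degree-k (regular v)) k-colourable

  colour : E H → Fin r
  colour = proj₁ colourable

  proper : ProperEdgeColouring H r colour
  proper = proj₂ colourable

  open ColourClasses H loopless regular colour proper public

  e∈⇒e′∈ : ∀ M → PerfectMatching H M → M e ≡ true → M e′ ≡ true
  e∈⇒e′∈ M pm p with proj₂ equivalent M pm
  ... | inj₁ none = ⊥-elim (false≢true (none e (pair-≡ˡ H e e′)) p)
  ... | inj₂ both = both e′ (pair-≡ʳ H e e′)

  e′∈⇒e∈ : ∀ M → PerfectMatching H M → M e′ ≡ true → M e ≡ true
  e′∈⇒e∈ M pm p with proj₂ equivalent M pm
  ... | inj₁ none = ⊥-elim (false≢true (none e′ (pair-≡ʳ H e e′)) p)
  ... | inj₂ both = both e (pair-≡ˡ H e e′)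

  -- the colour class of e is a perfect matching, so it contains e′ as well
  same-colour : colour e ≡ colour e′
  same-colour = sym (≡-class (e∈⇒e′∈ (class (colour e)) (class-perfect (colour e)) (class-≡ refl)))

  disjoint : ∀ {v} → Inc H v e → Inc H v e′ → ⊥
  disjoint i i′ = proper e e′ e≢e′ (_ , i , i′) same-colour

module Ports (H : Graph) (e e′ : E H) (x y x′ y′ : V H) where

  H⁻ : Graph
  H⁻ = deleteEdges H (pair H e e′)

  deleted : Bool → E H
  deleted true = e
  deleted false = e′

  port : Bool → Bool → V H
  port true true = x
  port true false = y
  port false true = x′
  port false false = y′

  Port : Bool × Bool → V H
  Port (s , t) = port s t

  kept : ∀ {g} → g ≢ e → g ≢ e′ → E H⁻
  kept {g} g≢e g≢e′ = g , subst (T ∘ not) (sym (pair-≢ H e e′ g g≢e g≢e′)) tt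

  is-port? : ∀ v → Dec (Σ (Bool × Bool) λ l → v ≡ Port l)
  is-port? v with _≟V_ H v x | _≟V_ H v y | _≟V_ H v x′ | _≟V_ H v y′
  ... | yes p | _ | _ | _ = yes ((true , true) , p)
  ... | no _ | yes p | _ | _ = yes ((true , false) , p)
  ... | no _ | no _ | yes p | _ = yes ((false , true) , p)
  ... | no _ | no _ | no _ | yes p = yes ((false , false) , p)
  ... | no a | no b | no c | no d = no λ { ((true , true) , p) → a p ; ((true , false) , p) → b p
                                          ; ((false , true) , p) → c p ; ((false , false) , p) → d p }

  pair-≢′ : ∀ s {g} → g ≢ deleted s → g ≢ deleted (not s) → pair H e e′ g ≡ false
  pair-≢′ true g≢e g≢e′ = pair-≢ H e e′ _ g≢e g≢e′
  pair-≢′ false g≢e′ g≢e = pair-≢ H e e′ _ g≢e g≢e′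

  kept′ : ∀ s {g} → g ≢ deleted s → g ≢ deleted (not s) → E H⁻
  kept′ s {g} g≢s g≢s′ = g , subst (T ∘ not) (sym (pair-≢′ s g≢s g≢s′)) tt

  _∪｛_｝ : (V H → Bool) → V H → V H → Bool
  S ∪｛ a ｝ = insert (_≟V_ H) S a

  deleted-or-kept : ∀ a → (Σ Bool λ s → a ≡ deleted s) ⊎ T (not (pair H e e′ a))
  deleted-or-kept a = classify (_≟E_ H a e) (_≟E_ H a e′)
    where
    classify : Dec (a ≡ e) → Dec (a ≡ e′) → (Σ Bool λ s → a ≡ deleted s) ⊎ T (not (pair H e e′ a))
    classify (yes a≡e) _ = inj₁ (true , a≡e)
    classify (no _) (yes a≡e′) = inj₁ (false , a≡e′)
    classify (no a≢e) (no a≢e′) = inj₂ (proj₂ (kept a≢e a≢e′))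

  module Facts (loopless : Loopless H) (x-y : Adj H e x y) (x′-y′ : Adj H e′ x′ y′)
    (disjoint : ∀ {v} → Inc H v e → Inc H v e′ → ⊥) where

    port-Inc : ∀ s t → Inc H (port s t) (deleted s)
    port-Inc true true = Adj⇒Inc₁ H x-y
    port-Inc true false = Adj⇒Inc₂ H x-y
    port-Inc false true = Adj⇒Inc₁ H x′-y′
    port-Inc false false = Adj⇒Inc₂ H x′-y′

    disjoint′ : ∀ s {v} → Inc H v (deleted s) → Inc H v (deleted (not s)) → ⊥
    disjoint′ true i j = disjoint i j
    disjoint′ false i j = disjoint j i

    port-injective : ∀ {s t s′ t′} → port s t ≡ port s′ t′ → s ≡ s′ × t ≡ t′
    port-injective {true} {true} {true} {true} p = refl , refl
    port-injective {true} {false} {true} {false} p = refl , refl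
    port-injective {false} {true} {false} {true} p = refl , refl
    port-injective {false} {false} {false} {false} p = refl , refl
    port-injective {true} {true} {true} {false} p = ⊥-elim (Adj⇒≢ H loopless x-y p)
    port-injective {true} {false} {true} {true} p = ⊥-elim (Adj⇒≢ H loopless x-y (sym p))
    port-injective {false} {true} {false} {false} p = ⊥-elim (Adj⇒≢ H loopless x′-y′ p)
    port-injective {false} {false} {false} {true} p = ⊥-elim (Adj⇒≢ H loopless x′-y′ (sym p))
    port-injective {true} {t} {false} {t′} p = ⊥-elim (disjoint (port-Inc true t) (subst (λ z → Inc H z e′) (sym p) (port-Inc false t′)))
    port-injective {false} {t} {true} {t′} p = ⊥-elim (disjoint (subst (λ z → Inc H z e) (sym p) (port-Inc true t′)) (port-Inc false t))

    Port-injective : Injective _≡_ _≡_ Port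
    Port-injective {s , t} {s′ , t′} p with port-injective {s} {t} {s′} {t′} p
    ... | refl , refl = refl

    port-≢ᵗ : ∀ s t → port s t ≢ port s (not t)
    port-≢ᵗ s true p = false≢true refl (sym (proj₂ (port-injective p)))
    port-≢ᵗ s false p = false≢true refl (proj₂ (port-injective p))

    port-≢ˢ : ∀ s t t′ → port s t ≢ port (not s) t′
    port-≢ˢ true t t′ p = false≢true refl (sym (proj₁ (port-injective p)))
    port-≢ˢ false t t′ p = false≢true refl (proj₁ (port-injective p))

    Inc-deleted⇒port : ∀ s {v} → Inc H v (deleted s) → Σ Bool λ t → v ≡ port s t
    Inc-deleted⇒port true i with Adj-ends H x-y i
    ... | inj₁ p = true , p
    ... | inj₂ p = false , p
    Inc-deleted⇒port false i with Adj-ends H x′-y′ i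
    ... | inj₁ p = true , p
    ... | inj₂ p = false , p

    step-from-non-port : ∀ {g u w} → Adj H g u w → ¬ (Σ (Bool × Bool) λ l → u ≡ Port l) → E H⁻
    step-from-non-port {g} {u} u-w not-port = kept (not-port ∘ at true) (not-port ∘ at false)
      where
      at : ∀ s → g ≡ deleted s → Σ (Bool × Bool) λ l → u ≡ Port l
      at s refl = let (t , p) = Inc-deleted⇒port s (Adj⇒Inc₁ H u-w) in (s , t) , p

    -- truncate at the first port: an edge leaving a non-port is neither e nor e′
    walk-to-port : ∀ {S u v} → WalkAvoiding H S u v → (Σ (Bool × Bool) λ l → v ≡ Port l) →
      Σ (Bool × Bool) λ l → WalkAvoiding H⁻ S u (Port l)
    walk-to-port {u = u} w v-port with is-port? u
    ... | yes (l , refl) = l , stay (WalkAvoiding-start H w)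
    walk-to-port (stay p) (l , refl) | no not-port = ⊥-elim (not-port (l , refl))
    walk-to-port (step g p u-w w) v-port | no not-port with walk-to-port w v-port
    ... | l , w′ = l , step (step-from-non-port u-w not-port) p u-w w′

    leaves-port : ∀ s t {g w} → Adj H g (port s t) w → w ≢ port s (not t) → g ≢ deleted s × g ≢ deleted (not s)
    leaves-port s t {g} {w} u-w w≢v = near , far
      where
      near : g ≢ deleted s
      near refl with Inc-deleted⇒port s (Adj⇒Inc₂ H u-w)
      ... | t′ , w≡ with t′ Bool.≟ t
      ...   | yes refl = Adj⇒≢ H loopless u-w (sym w≡)
      ...   | no t′≢t = w≢v (trans w≡ (cong (port s) (Bool.¬-not t′≢t)))
      far : g ≢ deleted (not s)
      far refl = disjoint′ s (port-Inc s t) (Adj⇒Inc₁ H u-w)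

    -- a walk avoiding one end of each deleted edge cannot use that edge
    blocked-walk : ∀ S s t t′ {u v} → WalkAvoiding H (S ∪｛ port s t ｝ ∪｛ port (not s) t′ ｝) u v → WalkAvoiding H⁻ S u v
    blocked-walk S s t t′ w =
      WalkAvoiding-mono H⁻ (λ z p → proj₁ (insert-∌⁻ (_≟V_ H) S (proj₁ (insert-∌⁻ (_≟V_ H) (S ∪｛ port s t ｝) p))))
        (WalkAvoiding-delete H (pair H e e′) (λ a-b Qa Qb → pair-≢′ s
          (avoided-vertex-blocks H (insert-mono (_≟V_ H) (S ∪｛ port s t ｝) (insert-∋ (_≟V_ H) S (port s t))) (port-Inc s t) a-b Qa Qb)
          (avoided-vertex-blocks H (insert-∋ (_≟V_ H) (S ∪｛ port s t ｝) (port (not s) t′)) (port-Inc (not s) t′) a-b Qa Qb)) w)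

    module Connectivity (four-connected : KConnected H 4) where

      private
        _≟_ : DecidableEquality (V H)
        _≟_ = _≟V_ H
        φ : HasSize (V H) (proj₁ (proj₁ four-connected))
        φ = proj₁ (proj₂ (proj₁ four-connected))
        4<n : 4 < proj₁ (proj₁ four-connected)
        4<n = proj₂ (proj₂ (proj₁ four-connected))

        within-∪ : ∀ S {zs} a → Within S zs → Within (S ∪｛ a ｝) (a ∷ zs)
        within-∪ = insert-within _≟_

        ∉-∪ : ∀ S {a w} → S w ≡ false → w ≢ a → (S ∪｛ a ｝) w ≡ false
        ∉-∪ = insert-∌ _≟_

        ∉-∪⁻ : ∀ S {a w} → (S ∪｛ a ｝) w ≡ false → S w ≡ false × w ≢ a
        ∉-∪⁻ = insert-∌⁻ _≟_

      small-within⇒connected : ∀ {S : V H → Bool} zs → Within S zs → length zs ≤ 3 → ConnectedAfterDeleting H S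
      small-within⇒connected {S} zs within ≤3 with size-fibre φ S true
      ... | m , ψ = proj₂ four-connected S m ψ (s≤s (ℕ.≤-trans (within⇒size≤ _≟_ ψ within) ≤3))

      outside⇒avoided : ∀ {S : V H → Bool} {zs v} → Within S zs → v ∉ zs → S v ≡ false
      outside⇒avoided within v∉ = Bool.¬-not (v∉ ∘ within _)

      fresh : ∀ zs → length zs ≤ 4 → Σ (V H) λ z → z ∉ zs
      fresh zs ≤4 = let (t , t∉) = injection-escapes _≟_ zs (to φ) (to-injective φ) (ℕ.≤-<-trans ≤4 4<n) in to φ t , t∉

      avoided-vertex : ∀ {S : V H → Bool} zs → Within S zs → length zs ≤ 4 → Σ (V H) λ v → S v ≡ false
      avoided-vertex zs within ≤4 = let (z , z∉) = fresh zs ≤4 in z , outside⇒avoided within z∉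

      neighbour-avoiding : ∀ {S : V H → Bool} zs → Within S zs → length zs ≤ 3 → ∀ {u} → S u ≡ false →
        Σ (E H) λ g → Σ (V H) λ w → Adj H g u w × S w ≡ false
      neighbour-avoiding {S} zs within ≤3 {u} Su with fresh (u ∷ zs) (s≤s ≤3)
      ... | z , z∉ = first-step (z∉ ∘ here) (small-within⇒connected zs within ≤3 u z Su (outside⇒avoided within (z∉ ∘ there)))
        where
        first-step : ∀ {z} → z ≢ u → WalkAvoiding H S u z → Σ (E H) λ g → Σ (V H) λ w → Adj H g u w × S w ≡ false
        first-step z≢u (stay _) = ⊥-elim (z≢u refl)
        first-step z≢u (step g _ u-w w) = g , _ , u-w , WalkAvoiding-start H w

      spare-end : ∀ s {u v} → u ≢ v →
        (Σ Bool λ t → port s t ≢ u × port s t ≢ v) ⊎ (Σ Bool λ t → u ≡ port s t × v ≡ port s (not t))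
      spare-end s {u} {v} u≢v with port s true ≟ u | port s true ≟ v | port s false ≟ u | port s false ≟ v
      ... | no a | no b | _ | _ = inj₁ (true , a , b)
      ... | _ | _ | no c | no d = inj₁ (false , c , d)
      ... | yes a | _ | yes c | _ = ⊥-elim (port-≢ᵗ s true (trans a (sym c)))
      ... | yes a | _ | no _ | yes d = inj₂ (true , sym a , sym d)
      ... | no _ | yes b | yes c | _ = inj₂ (false , sym c , sym b)
      ... | _ | yes b | _ | yes d = ⊥-elim (port-≢ᵗ s true (trans b (sym d)))

      -- from one end of a deleted edge to the other: leave along a kept edge, avoiding the far end
      across : ∀ {S : V H → Bool} zs → Within S zs → length zs ≤ 1 → ∀ s t →
        S (port s t) ≡ false → S (port s (not t)) ≡ false → WalkAvoiding H⁻ S (port s t) (port s (not t))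
      across {S} zs within ≤1 s t Su Sv
        with neighbour-avoiding (c ∷ v ∷ zs) (within-∪ (S ∪｛ v ｝) c (within-∪ S v within)) (s≤s (s≤s ≤1))
               (∉-∪ (S ∪｛ v ｝) (∉-∪ S Su (port-≢ᵗ s t)) (port-≢ˢ s t true))
        where
        v = port s (not t)
        c = port (not s) true
      ... | g , w , u-w , Q₁w with ∉-∪⁻ (S ∪｛ port s (not t) ｝) Q₁w
      ...   | Q₁′w , w≢c with ∉-∪⁻ S Q₁′w
      ...     | Sw , w≢v = step (kept′ s (proj₁ g-kept) (proj₂ g-kept)) Su u-w
                  (blocked-walk S s t true (small-within⇒connected (port (not s) true ∷ port s t ∷ zs)
                    (within-∪ (S ∪｛ port s t ｝) _ (within-∪ S _ within)) (s≤s (s≤s ≤1)) w (port s (not t))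
                    (∉-∪ (S ∪｛ port s t ｝) (∉-∪ S Sw (λ w≡u → Adj⇒≢ H loopless u-w (sym w≡u))) w≢c)
                    (∉-∪ (S ∪｛ port s t ｝) (∉-∪ S Sv (port-≢ᵗ s t ∘ sym)) (port-≢ˢ s (not t) true))))
        where g-kept = leaves-port s t u-w w≢v

      H⁻-connected : ∀ {S : V H → Bool} zs → Within S zs → length zs ≤ 1 →
        ∀ u v → S u ≡ false → S v ≡ false → WalkAvoiding H⁻ S u v
      H⁻-connected {S} zs within ≤1 u v Su Sv with u ≟ v
      ... | yes refl = stay Su
      ... | no u≢v with spare-end true u≢v | spare-end false u≢v
      ...   | inj₂ (t , refl , refl) | _ = across zs within ≤1 true t Su Sv
      ...   | inj₁ _ | inj₂ (t , refl , refl) = across zs within ≤1 false t Su Sv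
      ...   | inj₁ (ta , a≢u , a≢v) | inj₁ (tc , c≢u , c≢v) =
        blocked-walk S true ta tc (small-within⇒connected (port false tc ∷ port true ta ∷ zs)
          (within-∪ (S ∪｛ port true ta ｝) _ (within-∪ S _ within)) (s≤s (s≤s ≤1)) u v
          (∉-∪ (S ∪｛ port true ta ｝) (∉-∪ S Su (a≢u ∘ sym)) (c≢u ∘ sym))
          (∉-∪ (S ∪｛ port true ta ｝) (∉-∪ S Sv (a≢v ∘ sym)) (c≢v ∘ sym)))

      reaches-port : ∀ {S : V H → Bool} zs → Within S zs → length zs ≤ 3 → ∀ {u} → S u ≡ false →
        Σ (Bool × Bool) λ l → WalkAvoiding H⁻ S u (Port l)
      reaches-port zs within ≤3 {u} Su with injection-escapes _≟_ zs (Port ∘ to labels) (to-injective labels ∘ Port-injective) (s≤s ≤3)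
        where labels = ↔-trans Fin.*↔× (Fin.2↔Bool ×-↔ Fin.2↔Bool)
      ... | t , t∉ = walk-to-port (small-within⇒connected zs within ≤3 u _ Su (outside⇒avoided within t∉)) (_ , refl)

      reaches-two-ports : ∀ {S : V H → Bool} zs → Within S zs → length zs ≤ 2 → ∀ {u} → S u ≡ false →
        Σ (Bool × Bool) λ l₁ → Σ (Bool × Bool) λ l₂ →
          l₁ ≢ l₂ × WalkAvoiding H⁻ S u (Port l₁) × WalkAvoiding H⁻ S u (Port l₂)
      reaches-two-ports {S} zs within ≤2 {u} Su with is-port? u
      ... | no not-port with reaches-port zs within (ℕ.m≤n⇒m≤1+n ≤2) Su
      ...   | l₁ , w₁ with reaches-port (Port l₁ ∷ zs) (within-∪ S _ within) (s≤s ≤2) (∉-∪ S Su (not-port ∘ (l₁ ,_)))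
      ...     | l₂ , w₂ = l₁ , l₂ , (λ l₁≡l₂ → proj₂ (∉-∪⁻ S (WalkAvoiding-end H⁻ w₂)) (cong Port (sym l₁≡l₂))) ,
                          w₁ , WalkAvoiding-mono H⁻ (λ z p → proj₁ (∉-∪⁻ S p)) w₂
      reaches-two-ports {S} zs within ≤2 {u} Su | yes ((s , t) , refl)
        with neighbour-avoiding (port s (not t) ∷ zs) (within-∪ S _ within) (s≤s ≤2) (∉-∪ S Su (port-≢ᵗ s t))
      ... | g , w , u-w , Q₁w with ∉-∪⁻ S Q₁w
      ...   | Sw , w≢v with reaches-port (port s t ∷ zs) (within-∪ S _ within) (s≤s ≤2)
                            (∉-∪ S Sw (λ w≡u → Adj⇒≢ H loopless u-w (sym w≡u)))
      ...     | l , w′ = (s , t) , l , (λ st≡l → proj₂ (∉-∪⁻ S (WalkAvoiding-end H⁻ w′)) (cong Port (sym st≡l))) ,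
                         stay Su , step (kept′ s (proj₁ g-kept) (proj₂ g-kept)) Su u-w
                                     (WalkAvoiding-mono H⁻ (λ z p → proj₁ (∉-∪⁻ S p)) w′)
        where g-kept = leaves-port s t u-w w≢v

-- The chain C

module Chain {k : ℕ} (3≤k : 3 ≤ k) (G : Fin k → Graph) (loopless : ∀ i → Loopless (G i))
  {r} (regular : ∀ i → Regular (G i) r) (class1 : ∀ i → Class1 (G i))
  (e e′ : (i : Fin k) → E (G i)) (x y x′ y′ : (i : Fin k) → V (G i)) (e≢e′ : ∀ i → e i ≢ e′ i)
  (x-y : ∀ i → Adj (G i) (e i) (x i) (y i)) (x′-y′ : ∀ i → Adj (G i) (e′ i) (x′ i) (y′ i))
  (equivalent : ∀ i → EquivalentSet (G i) (pair (G i) (e i) (e′ i))) where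

  open Construction G e e′ x y x′ y′ public

  module Pair (i : Fin k) = EquivalentPair (G i) (loopless i) (regular i) (class1 i) (e i) (e′ i) (e≢e′ i) (equivalent i)
  module Zone (i : Fin k) where
    open Ports (G i) (e i) (e′ i) (x i) (y i) (x′ i) (y′ i) public
    open Facts (loopless i) (x-y i) (x′-y′ i) (Pair.disjoint i) public

  next≢ : ∀ i → next i ≢ i
  next≢ = next-moves (ℕ.≤-trans (s≤s (s≤s z≤n)) 3≤k)

  zone₀ : Fin k
  zone₀ = fromℕ< (ℕ.≤-trans (s≤s z≤n) 3≤k)

  zone≡ : ∀ {i j} {a : V (G i)} {b : V (G j)} → _≡_ {A = V C} (i , a) (j , b) → i ≡ j
  zone≡ refl = refl

  vertex≡ : ∀ {i} {a b : V (G i)} → _≡_ {A = V C} (i , a) (i , b) → a ≡ b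
  vertex≡ refl = refl

  split≡ : ∀ {i i′} {a : V (G i)} {b : V (G i′)} → _≡_ {A = V C} (i , a) (i′ , b) →
    Σ (i ≡ i′) λ q → subst (V ∘ G) q a ≡ b
  split≡ refl = refl , refl

  loopless-C : Loopless C
  loopless-C (inj₁ (i , (a , _))) eq = loopless i a (vertex≡ eq)
  loopless-C (inj₂ (i , true)) eq = next≢ i (sym (zone≡ eq))
  loopless-C (inj₂ (i , false)) eq = next≢ i (sym (zone≡ eq))

  port : (i : Fin k) → Bool → Bool → V (G i)
  port i = Zone.port i

  -- the f-edge (j , s) runs from port s true of zone j to port s false of zone next j
  f-zone : Fin k → Bool → Fin k
  f-zone j true = j
  f-zone j false = next j

  f-end : Fin k → Bool → Bool → V C
  f-end j s t = f-zone j t , port (f-zone j t) s t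

  endAt-f : ∀ j s t → endAt C (inj₂ (j , s)) t ≡ f-end j s t
  endAt-f j true true = refl
  endAt-f j true false = refl
  endAt-f j false true = refl
  endAt-f j false false = refl

  port-injectiveᶜ : ∀ {i i′} s t s′ t′ (q : i ≡ i′) → subst (V ∘ G) q (port i s t) ≡ port i′ s′ t′ → s ≡ s′ × t ≡ t′
  port-injectiveᶜ {i} s t s′ t′ refl p = Zone.port-injective i {s} {t} {s′} {t′} p

  f-end-injective : ∀ j s t j′ s′ t′ → f-end j s t ≡ f-end j′ s′ t′ → j ≡ j′ × s ≡ s′ × t ≡ t′
  f-end-injective j s t j′ s′ t′ p with split≡ p
  ... | q , q′ = zones t t′ (proj₂ ports) q , ports
    where
    ports = port-injectiveᶜ s t s′ t′ q q′
    zones : ∀ t t′ → t ≡ t′ → f-zone j t ≡ f-zone j′ t′ → j ≡ j′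
    zones true .true refl q = q
    zones false .false refl q = next-injective q

  Inc-f : ∀ {w} j s → Inc C w (inj₂ (j , s)) → Σ Bool λ t → f-end j s t ≡ w
  Inc-f j s i with Inc⇒endAt C i
  ... | t , p = t , trans (sym (endAt-f j s t)) p

  Inc-internal : ∀ {w} i a → Inc C w (inj₁ (i , a)) → Σ (V (G i)) λ v → w ≡ (i , v) × Inc (G i) v (proj₁ a)
  Inc-internal i (a , _) (inj₁ refl) = end₁ (G i) a , refl , inj₁ refl
  Inc-internal i (a , _) (inj₂ refl) = end₂ (G i) a , refl , inj₂ refl

  kept⇒≢e : ∀ {j a} → T (not (pair (G j) (e j) (e′ j) a)) → a ≢ e j
  kept⇒≢e {j} na refl = subst (T ∘ not) (pair-≡ˡ (G j) (e j) (e′ j)) na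

  kept⇒≢e′ : ∀ {j a} → T (not (pair (G j) (e j) (e′ j) a)) → a ≢ e′ j
  kept⇒≢e′ {j} na refl = subst (T ∘ not) (pair-≡ʳ (G j) (e j) (e′ j)) na

  kept⇒≢deleted : ∀ s {j a} → T (not (pair (G j) (e j) (e′ j) a)) → a ≢ Zone.deleted j s
  kept⇒≢deleted true = kept⇒≢e
  kept⇒≢deleted false = kept⇒≢e′

  module Regularity where

    private
      port-endAt : ∀ i s t → Σ Bool λ b → endAt (G i) (Zone.deleted i s) b ≡ port i s t
      port-endAt i s t = Inc⇒endAt (G i) (Zone.port-Inc i s t)

      from-prev : (P : ∀ i → V (G i)) → ∀ {i v} → P i ≡ v → _≡_ {A = V C} (next (prev i) , P (next (prev i))) (i , v)
      from-prev P {i} p rewrite next-prev i = cong (i ,_) p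

      internal-end : ∀ {i} a b {na v} → endAt (G i) a b ≡ v → endAt C (inj₁ (i , (a , na))) b ≡ (i , v)
      internal-end a true p = cong (_ ,_) p
      internal-end a false p = cong (_ ,_) p

    to-zone : ∀ {i v} → Incidences C (i , v) → Incidences (G i) v
    to-zone (inj₁ (j , (a , _)) , true , refl) = a , true , refl
    to-zone (inj₁ (j , (a , _)) , false , refl) = a , false , refl
    to-zone (inj₂ (j , true) , true , refl) = e j , port-endAt j true true
    to-zone (inj₂ (j , true) , false , refl) = e (next j) , port-endAt (next j) true false
    to-zone (inj₂ (j , false) , true , refl) = e′ j , port-endAt j false true
    to-zone (inj₂ (j , false) , false , refl) = e′ (next j) , port-endAt (next j) false false

    from-zone : ∀ {i v} → Incidences (G i) v → Incidences C (i , v)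
    from-zone {i} {v} (a , b , p) with _≟E_ (G i) a (e i)
    ... | yes refl with _≟V_ (G i) v (x i)
    ...   | yes v≡x = inj₂ (i , true) , true , cong (i ,_) (sym v≡x)
    ...   | no v≢x = inj₂ (prev i , true) , false , from-prev y (sym (Adj-other-end (G i) (loopless i) b (x-y i) p v≢x))
    from-zone {i} {v} (a , b , p) | no a≢e with _≟E_ (G i) a (e′ i)
    ... | yes refl with _≟V_ (G i) v (x′ i)
    ...   | yes v≡x′ = inj₂ (i , false) , true , cong (i ,_) (sym v≡x′)
    ...   | no v≢x′ = inj₂ (prev i , false) , false , from-prev y′ (sym (Adj-other-end (G i) (loopless i) b (x′-y′ i) p v≢x′))
    from-zone {i} {v} (a , b , p) | no a≢e | no a≢e′ = inj₁ (i , Zone.kept i a≢e a≢e′) , b , internal-end a b p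

    private
      to-zone-f : ∀ j {i w} s t (r : endAt C (inj₂ (j , s)) t ≡ (i , w)) →
        proj₁ (to-zone (inj₂ (j , s) , t , r)) ≡ Zone.deleted i s
      to-zone-f j true true refl = refl
      to-zone-f j true false refl = refl
      to-zone-f j false true refl = refl
      to-zone-f j false false refl = refl

      to-zone-internal : ∀ {i w} (a : E (G⁻ i)) b (q : endAt C (inj₁ (i , a)) b ≡ (i , w)) →
        proj₁ (to-zone (inj₁ (i , a) , b , q)) ≡ proj₁ a
      to-zone-internal (a , na) true refl = refl
      to-zone-internal (a , na) false refl = refl

    to-zone-from-zone : ∀ {i v} (z : Incidences (G i) v) → proj₁ (to-zone (from-zone z)) ≡ proj₁ z
    to-zone-from-zone {i} {v} (a , b , p) with _≟E_ (G i) a (e i)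
    ... | yes refl with _≟V_ (G i) v (x i)
    ...   | yes v≡x = to-zone-f i true true (cong (i ,_) (sym v≡x))
    ...   | no v≢x = to-zone-f (prev i) true false (from-prev y (sym (Adj-other-end (G i) (loopless i) b (x-y i) p v≢x)))
    to-zone-from-zone {i} {v} (a , b , p) | no a≢e with _≟E_ (G i) a (e′ i)
    ... | yes refl with _≟V_ (G i) v (x′ i)
    ...   | yes v≡x′ = to-zone-f i false true (cong (i ,_) (sym v≡x′))
    ...   | no v≢x′ = to-zone-f (prev i) false false (from-prev y′ (sym (Adj-other-end (G i) (loopless i) b (x′-y′ i) p v≢x′)))
    to-zone-from-zone {i} {v} (a , b , p) | no a≢e | no a≢e′ = to-zone-internal _ b (internal-end a b p)

    private
      underlying : E C → (Σ (Fin k) λ j → E (G j)) ⊎ (Fin k × Bool)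
      underlying (inj₁ (j , (a , _))) = inj₁ (j , a)
      underlying (inj₂ z) = inj₂ z

      underlying-injective : ∀ {g h} → underlying g ≡ underlying h → g ≡ h
      underlying-injective {inj₁ (j , (a , p))} {inj₁ (.j , (.a , q))} refl = cong (λ z → inj₁ (j , (a , z))) (Bool.T-irrelevant p q)
      underlying-injective {inj₂ _} {inj₂ _} refl = refl

      from-zone-internal : ∀ j a b → a ≢ e j → a ≢ e′ j → underlying (proj₁ (from-zone {j} (a , b , refl))) ≡ inj₁ (j , a)
      from-zone-internal j a b a≢e a≢e′ with _≟E_ (G j) a (e j)
      ... | yes a≡e = ⊥-elim (a≢e a≡e)
      ... | no _ with _≟E_ (G j) a (e′ j)
      ...   | yes a≡e′ = ⊥-elim (a≢e′ a≡e′)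
      from-zone-internal j a true a≢e a≢e′ | no _ | no _ = refl
      from-zone-internal j a false a≢e a≢e′ | no _ | no _ = refl

    from-zone-to-zone : ∀ {i v} (w : Incidences C (i , v)) → proj₁ (from-zone (to-zone w)) ≡ proj₁ w
    from-zone-to-zone (inj₁ (j , (a , na)) , true , refl) = underlying-injective (from-zone-internal j a true (kept⇒≢e na) (kept⇒≢e′ na))
    from-zone-to-zone (inj₁ (j , (a , na)) , false , refl) = underlying-injective (from-zone-internal j a false (kept⇒≢e na) (kept⇒≢e′ na))
    from-zone-to-zone (inj₂ (j , true) , true , refl) with _≟E_ (G j) (e j) (e j)
    ... | no e≢e = ⊥-elim (e≢e refl)
    ... | yes refl with _≟V_ (G j) (x j) (x j)
    ...   | yes _ = refl
    ...   | no x≢x = ⊥-elim (x≢x refl)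
    from-zone-to-zone (inj₂ (j , true) , false , refl) with _≟E_ (G (next j)) (e (next j)) (e (next j))
    ... | no e≢e = ⊥-elim (e≢e refl)
    ... | yes refl with _≟V_ (G (next j)) (y (next j)) (x (next j))
    ...   | yes y≡x = ⊥-elim (Adj⇒≢ (G (next j)) (loopless (next j)) (x-y (next j)) (sym y≡x))
    ...   | no _ = cong (λ z → inj₂ (z , true)) (prev-next j)
    from-zone-to-zone (inj₂ (j , false) , true , refl) with _≟E_ (G j) (e′ j) (e j)
    ... | yes e′≡e = ⊥-elim (e≢e′ j (sym e′≡e))
    ... | no _ with _≟E_ (G j) (e′ j) (e′ j)
    ...   | no e′≢e′ = ⊥-elim (e′≢e′ refl)
    ...   | yes refl with _≟V_ (G j) (x′ j) (x′ j)
    ...     | yes _ = refl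
    ...     | no x′≢x′ = ⊥-elim (x′≢x′ refl)
    from-zone-to-zone (inj₂ (j , false) , false , refl) with _≟E_ (G (next j)) (e′ (next j)) (e (next j))
    ... | yes e′≡e = ⊥-elim (e≢e′ (next j) (sym e′≡e))
    ... | no _ with _≟E_ (G (next j)) (e′ (next j)) (e′ (next j))
    ...   | no e′≢e′ = ⊥-elim (e′≢e′ refl)
    ...   | yes refl with _≟V_ (G (next j)) (y′ (next j)) (x′ (next j))
    ...     | yes y′≡x′ = ⊥-elim (Adj⇒≢ (G (next j)) (loopless (next j)) (x′-y′ (next j)) (sym y′≡x′))
    ...     | no _ = cong (λ z → inj₂ (z , false)) (prev-next j)

  regular-C : Regular C r
  regular-C (i , v) = ↔-trans (regular i v) (mk↔ₛ′ from-zone to-zone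
    (λ w → incidence-injective C loopless-C _ _ (from-zone-to-zone w))
    (λ z → incidence-injective (G i) (loopless i) _ _ (to-zone-from-zone z)))
    where open Regularity

  module Colouring (1≤r : 1 ≤ r) where

    α₀ : Fin r
    α₀ = fromℕ< 1≤r

    -- in zone i, swap the colour of e i (which e′ i shares) with α₀, the colour of every f-edge
    recolour : (i : Fin k) → Fin r → Fin r
    recolour i = transpose (Pair.colour i (e i)) α₀

    colour-C : E C → Fin r
    colour-C (inj₁ (i , (a , _))) = recolour i (Pair.colour i a)
    colour-C (inj₂ _) = α₀

    private
      deleted-colour : ∀ s i → Pair.colour i (Zone.deleted i s) ≡ Pair.colour i (e i)
      deleted-colour true i = refl
      deleted-colour false i = sym (Pair.same-colour i)

      recolour-α₀ : ∀ i {β} → recolour i β ≡ α₀ → β ≡ Pair.colour i (e i)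
      recolour-α₀ i eq = transpose-injective (Pair.colour i (e i)) α₀ (trans eq (sym (transpose-matchˡ (Pair.colour i (e i)) α₀)))

      internal-meets-f : ∀ i a na j s {w} → Inc C w (inj₁ (i , (a , na))) → Inc C w (inj₂ (j , s)) →
        recolour i (Pair.colour i a) ≢ α₀
      internal-meets-f i a na j s w∈a w∈f eq with Inc-internal i (a , na) w∈a | Inc-f j s w∈f
      ... | v , refl , v∈a | t , refl =
        Pair.proper i a (Zone.deleted i s) (kept⇒≢deleted s na) (v , v∈a , Zone.port-Inc i s t)
          (trans (recolour-α₀ (f-zone j t) eq) (sym (deleted-colour s (f-zone j t))))

    proper-C : ProperEdgeColouring C r colour-C
    proper-C (inj₁ (i , (a , na))) (inj₁ (j , (b , nb))) a≢b (w , w∈a , w∈b) eq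
      with Inc-internal i (a , na) w∈a | Inc-internal j (b , nb) w∈b
    ... | v , refl , v∈a | v′ , q , v′∈b with split≡ q
    ... | refl , refl = Pair.proper i a b (λ { refl → a≢b (cong (λ z → inj₁ (i , (a , z))) (Bool.T-irrelevant na nb)) })
                          (v , v∈a , v′∈b) (transpose-injective (Pair.colour i (e i)) α₀ eq)
    proper-C (inj₁ (i , (a , na))) (inj₂ (j , s)) _ (w , w∈a , w∈f) eq = internal-meets-f i a na j s w∈a w∈f eq
    proper-C (inj₂ (j , s)) (inj₁ (i , (a , na))) _ (w , w∈f , w∈a) eq = internal-meets-f i a na j s w∈a w∈f (sym eq)
    proper-C (inj₂ (j , s)) (inj₂ (j′ , s′)) f≢f' (w , w∈f , w∈f') eq with Inc-f j s w∈f | Inc-f j′ s′ w∈f'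
    ... | t , p | t′ , p′ with f-end-injective j s t j′ s′ t′ (trans p (sym p′))
    ... | refl , refl , refl = f≢f' refl

    class1-C : Class1 C
    class1-C = r , ((colour-C , proper-C) , λ j (c , proper) → degree≤colours C loopless-C c (regular-C w₀) proper) ,
               ((λ v n degree-n → ℕ.≤-reflexive (size-unique degree-n (regular-C v))) , (w₀ , regular-C w₀))
      where w₀ = zone₀ , x zone₀

  is-f : E C → Bool
  is-f (inj₁ _) = false
  is-f (inj₂ _) = true

  internal-stays : ∀ w g (i : Inc C w g) → is-f g ≡ false → proj₁ (other-end C loopless-C g i) ≡ proj₁ w
  internal-stays w (inj₁ _) (inj₁ refl) _ = refl
  internal-stays w (inj₁ _) (inj₂ refl) _ = refl

  -- boundary i s t is the f-edge whose end t is port s t of zone next i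
  boundary : Fin k → Bool → Bool → E C
  boundary i s true = inj₂ (next i , s)
  boundary i s false = inj₂ (i , s)

  internal≢boundary : ∀ {z} i s t → inj₁ z ≢ boundary i s t
  internal≢boundary i s true ()
  internal≢boundary i s false ()

  boundary-is-f : ∀ i s t → is-f (boundary i s t) ≡ true
  boundary-is-f i s true = refl
  boundary-is-f i s false = refl

  boundary-Inc : ∀ i s t → Inc C (next i , port (next i) s t) (boundary i s t)
  boundary-Inc i s true = endAt⇒Inc C true (endAt-f (next i) s true)
  boundary-Inc i s false = endAt⇒Inc C false (endAt-f i s false)

  Inc-boundary : ∀ i v g → Inc C (next i , v) g → is-f g ≡ true →
    Σ Bool λ s → Σ Bool λ t → v ≡ port (next i) s t × g ≡ boundary i s t
  Inc-boundary i v (inj₂ (j , s)) v∈g _ with Inc-f j s v∈g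
  ... | t , p with split≡ p
  Inc-boundary i v (inj₂ (j , s)) v∈g _ | true , p | q , q′ = s , true , lemma q q′ , cong (λ z → inj₂ (z , s)) q
    where
    lemma : ∀ {a b} {w : V (G b)} (q : a ≡ b) → subst (V ∘ G) q (port a s true) ≡ w → w ≡ port b s true
    lemma refl refl = refl
  Inc-boundary i v (inj₂ (j , s)) v∈g _ | false , p | q , q′ = s , false , lemma q q′ , cong (λ z → inj₂ (z , s)) (next-injective q)
    where
    lemma : ∀ {a b} {w : V (G b)} (q : a ≡ b) → subst (V ∘ G) q (port a s false) ≡ w → w ≡ port b s false
    lemma refl refl = refl

  module Matching (M : EdgeSet C) (perfect : PerfectMatching C M) where

    open Mates C loopless-C M perfect

    boundary-mate : ∀ i s t → M (boundary i s t) ≡ true → edge (next i , port (next i) s t) ≡ boundary i s t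
    boundary-mate i s t m = sym (edge-unique _ _ m (boundary-Inc i s t))

    module ZoneParity (i : Fin k) {n} (φ : HasSize (V (G (next i))) n) where

      Zone-vertex : Set
      Zone-vertex = Σ (V C) λ w → proj₁ w ≡ next i

      zone-size : HasSize Zone-vertex n
      zone-size = ↔-trans φ (mk↔ₛ′ (λ v → (next i , v) , refl) (λ { ((_ , v) , refl) → v })
                                  (λ { ((_ , v) , refl) → refl }) (λ v → refl))

      matched-outside : Zone-vertex → Bool
      matched-outside z = is-f (edge (proj₁ z))

      private
        ≡-by-vertex : ∀ {β} {a b : Σ Zone-vertex λ z → matched-outside z ≡ β} → proj₁ (proj₁ a) ≡ proj₁ (proj₁ b) → a ≡ b
        ≡-by-vertex {a = (w , p) , q} {(.w , p′) , q′} refl with ≡-irrelevant p p′ | ≡-irrelevant q q′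
        ... | refl | refl = refl

        mate-inside : (Σ Zone-vertex λ z → matched-outside z ≡ false) → Σ Zone-vertex λ z → matched-outside z ≡ false
        mate-inside ((w , in-zone) , inside) =
          (mate w , trans (internal-stays w (edge w) (edge-Inc w) inside) in-zone) , trans (cong is-f (edge-mate w)) inside

      inside-even : ∀ {m} → HasSize (Σ Zone-vertex λ z → matched-outside z ≡ false) m → 2 ∣ m
      inside-even ψ = involution⇒even ψ mate-inside (λ z → ≡-by-vertex (mate-involutive _))
                        (λ z eq → mate-≢ _ (cong (proj₁ ∘ proj₁) eq))

      private
        B : Bool → Bool → Bool
        B s t = M (boundary i s t)

        Matched-boundary : Set
        Matched-boundary = Σ (Bool × Bool) λ st → B (proj₁ st) (proj₂ st) ≡ true

        from-boundary : Matched-boundary → Σ Zone-vertex λ z → matched-outside z ≡ true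
        from-boundary ((s , t) , m) = ((next i , port (next i) s t) , refl) , trans (cong is-f (boundary-mate i s t m)) (boundary-is-f i s t)

        to-boundary : (Σ Zone-vertex λ z → matched-outside z ≡ true) → Matched-boundary
        to-boundary (((_ , v) , refl) , outside) with Inc-boundary i v (edge (next i , v)) (edge-Inc _) outside
        ... | s , t , _ , edge≡ = (s , t) , trans (cong M (sym edge≡)) (edge-∈ _)

        from-to-boundary : ∀ z → from-boundary (to-boundary z) ≡ z
        from-to-boundary (((_ , v) , refl) , outside) with Inc-boundary i v (edge (next i , v)) (edge-Inc _) outside
        ... | s , t , v≡ , _ = ≡-by-vertex (cong (next i ,_) (sym v≡))

        to-from-boundary : ∀ z → to-boundary (from-boundary z) ≡ z
        to-from-boundary ((s , t) , m) with Inc-boundary i (port (next i) s t) (edge (next i , port (next i) s t)) (edge-Inc _)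
                                     (trans (cong is-f (boundary-mate i s t m)) (boundary-is-f i s t))
        ... | s′ , t′ , v≡ , _ with Zone.port-injective (next i) v≡
        ... | refl , refl = cong ((s , t) ,_) (≡-irrelevant _ _)

      outside↔boundary : Matched-boundary ↔ (Σ Zone-vertex λ z → matched-outside z ≡ true)
      outside↔boundary = mk↔ₛ′ from-boundary to-boundary from-to-boundary to-from-boundary

      parity : B true true xor (B true false xor (B false true xor B false false)) ≡ false
      parity with size-fibres zone-size matched-outside
      ... | m₁ , m₂ , ψ₁ , ψ₂ , n≡ = even-count⇒xor≡false (B true true) (B true false) (B false true) (B false false)
            (subst (2 ∣_) (size-unique ψ₁ (↔-trans (size-count² B) outside↔boundary)) 2∣m₁)
        where
        2∣n : 2 ∣ n
        2∣n = Mates.order-even (G (next i)) (loopless (next i)) _ (Pair.class-perfect (next i) (Pair.colour (next i) (e (next i)))) φ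
        2∣m₁ : 2 ∣ m₁
        2∣m₁ = ∣m+n∣m⇒∣n (subst (2 ∣_) (trans n≡ (ℕ.+-comm m₁ m₂)) 2∣n) (inside-even ψ₂)

    -- if side s₀ uses both f-edges at zone j = next i and the other side none, then M restricted
    -- to zone j, completed by the deleted edge of side s₀, is a perfect matching of G j separating e j from e′ j
    module Restriction (i : Fin k) (s₀ : Bool)
      (side-in : ∀ t → M (boundary i s₀ t) ≡ true) (side-out : ∀ t → M (boundary i (not s₀) t) ≡ false) where

      private
        j = next i

      restrict : EdgeSet (G j)
      restrict a = [ (λ (s , _) → not (s xor s₀)) , (λ na → M (inj₁ (j , (a , na)))) ]′ (Zone.deleted-or-kept j a)

      restrict-kept : ∀ a na → restrict a ≡ M (inj₁ (j , (a , na)))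
      restrict-kept a na with Zone.deleted-or-kept j a
      ... | inj₁ (s , refl) = ⊥-elim (kept⇒≢deleted s na refl)
      ... | inj₂ na′ = cong (λ z → M (inj₁ (j , (a , z)))) (Bool.T-irrelevant na′ na)

      restrict-deleted : ∀ s → restrict (Zone.deleted j s) ≡ not (s xor s₀)
      restrict-deleted s with Zone.deleted-or-kept j (Zone.deleted j s)
      ... | inj₁ (s′ , eq) = cong (λ z → not (z xor s₀)) (sym (deleted-injective s s′ eq))
        where
        deleted-injective : ∀ s s′ → Zone.deleted j s ≡ Zone.deleted j s′ → s ≡ s′
        deleted-injective true true _ = refl
        deleted-injective false false _ = refl
        deleted-injective true false e≡e′ = ⊥-elim (e≢e′ j e≡e′)
        deleted-injective false true e′≡e = ⊥-elim (e≢e′ j (sym e′≡e))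
      ... | inj₂ na = ⊥-elim (kept⇒≢deleted s na refl)

      restricted-side : ∀ s → restrict (Zone.deleted j s) ≡ true → s ≡ s₀
      restricted-side s m = agree s s₀ (trans (sym (restrict-deleted s)) m)
        where
        agree : ∀ s s₀ → not (s xor s₀) ≡ true → s ≡ s₀
        agree true true _ = refl
        agree false false _ = refl

      deleted-s₀ : restrict (Zone.deleted j s₀) ≡ true
      deleted-s₀ = trans (restrict-deleted s₀) (cong not (Bool.xor-same s₀))

      boundary-side : ∀ s t → M (boundary i s t) ≡ true → s ≡ s₀
      boundary-side s t m with s Bool.≟ s₀
      ... | yes s≡s₀ = s≡s₀
      ... | no s≢s₀ = ⊥-elim (false≢true (subst (λ z → M (boundary i z t) ≡ false) (sym (Bool.¬-not s≢s₀)) (side-out t)) m)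

      lift-Inc : ∀ {v a} na → Inc (G j) v a → Inc C (j , v) (inj₁ (j , (a , na)))
      lift-Inc na (inj₁ p) = inj₁ (cong (j ,_) p)
      lift-Inc na (inj₂ p) = inj₂ (cong (j ,_) p)

      kept-matched : ∀ {v a} na → restrict a ≡ true → Inc (G j) v a → inj₁ (j , (a , na)) ≡ edge (j , v)
      kept-matched na m v∈a = edge-unique _ _ (trans (sym (restrict-kept _ na)) m) (lift-Inc na v∈a)

      unique-at-port : ∀ v s t → v ≡ port j s t → edge (j , v) ≡ boundary i s t → UniqueAt (G j) (loopless j) v restrict
      unique-at-port v s t refl edge≡ with boundary-side s t (trans (cong M (sym edge≡)) (edge-∈ _))
      ... | refl = Zone.deleted j s , (deleted-s₀ , Zone.port-Inc j s t) , only
        where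
        only : ∀ a → restrict a ≡ true → Inc (G j) v a → a ≡ Zone.deleted j s
        only a m v∈a = [ (λ { (s′ , refl) → cong (Zone.deleted j) (restricted-side s′ m) })
                       , (λ na → ⊥-elim (internal≢boundary i s t (trans (kept-matched na m v∈a) edge≡))) ]′ (Zone.deleted-or-kept j a)

      unique-inside : ∀ v a na → edge (j , v) ≡ inj₁ (j , (a , na)) → Inc (G j) v a → UniqueAt (G j) (loopless j) v restrict
      unique-inside v a na edge≡ v∈a = a , (trans (restrict-kept a na) (trans (cong M (sym edge≡)) (edge-∈ _)) , v∈a) , only
        where
        only : ∀ a′ → restrict a′ ≡ true → Inc (G j) v a′ → a′ ≡ a
        only a′ m v∈a′ = [ (λ { (s′ , refl) → at-port s′ m v∈a′ })
                         , (λ na′ → case trans (kept-matched na′ m v∈a′) edge≡ of λ { refl → refl }) ]′ (Zone.deleted-or-kept j a′)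
          where
          at-port : ∀ s′ → restrict (Zone.deleted j s′) ≡ true → Inc (G j) v (Zone.deleted j s′) → Zone.deleted j s′ ≡ a
          at-port s′ m v∈a′ with restricted-side s′ m | Zone.Inc-deleted⇒port j s′ v∈a′
          ... | refl | t , refl = ⊥-elim (internal≢boundary i s₀ t (trans (sym edge≡) (boundary-mate i s₀ t (side-in t))))

      unique : ∀ v g → edge (j , v) ≡ g → UniqueAt (G j) (loopless j) v restrict
      unique v (inj₂ _) edge≡ with Inc-boundary i v (edge (j , v)) (edge-Inc _) (cong is-f edge≡)
      ... | s , t , v≡ , edge≡′ = unique-at-port v s t v≡ edge≡′
      unique v (inj₁ (j′ , (a , na))) edge≡ with Inc-internal j′ (a , na) (subst (Inc C (j , v)) edge≡ (edge-Inc (j , v)))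
      ... | _ , refl , v∈a = unique-inside v a na edge≡ v∈a

      restrict-perfect : PerfectMatching (G j) restrict
      restrict-perfect = uniqueAt⇒perfect (G j) (loopless j) restrict λ v → unique v (edge (j , v)) refl

      separates : ⊥
      separates = on-side s₀ refl
        where
        on-e : ∀ b → s₀ ≡ b → restrict (e j) ≡ not (true xor b)
        on-e b refl = restrict-deleted true
        on-e′ : ∀ b → s₀ ≡ b → restrict (e′ j) ≡ not (false xor b)
        on-e′ b refl = restrict-deleted false
        on-side : ∀ b → s₀ ≡ b → ⊥
        on-side true eq = false≢true (on-e′ true eq) (Pair.e∈⇒e′∈ j restrict restrict-perfect (on-e true eq))
        on-side false eq = false≢true (on-e false eq) (Pair.e′∈⇒e∈ j restrict restrict-perfect (on-e′ false eq))

    private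
      -- a = M (f (next i)), b = M (f i), c = M (f' (next i)), d = M (f' i)
      alternation-step : ∀ a b c d → (a xor (b xor (c xor d))) ≡ false →
        ¬ (a ≡ true × b ≡ true × c ≡ false × d ≡ false) → ¬ (a ≡ false × b ≡ false × c ≡ true × d ≡ true) →
        b ≢ d → a ≢ c × a ≡ not b
      alternation-step true true false false _ one-sided _ _ = ⊥-elim (one-sided (refl , refl , refl , refl))
      alternation-step false false true true _ _ one-sided _ = ⊥-elim (one-sided (refl , refl , refl , refl))
      alternation-step true false false true _ _ _ _ = (λ ()) , refl
      alternation-step false true true false _ _ _ _ = (λ ()) , refl
      alternation-step a true c true _ _ _ b≢d = ⊥-elim (b≢d refl)
      alternation-step a false c false _ _ _ b≢d = ⊥-elim (b≢d refl)
      alternation-step true true true false () _ _ _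
      alternation-step false true false false () _ _ _
      alternation-step true false true true () _ _ _
      alternation-step false false false true () _ _ _

    alternation : (∀ i → ∃ λ n → HasSize (V (G i)) n) → ∀ i → M (f i) ≢ M (f' i) →
      M (f (next i)) ≢ M (f' (next i)) × M (f (next i)) ≡ not (M (f i))
    alternation finite i = alternation-step _ _ _ _ (ZoneParity.parity i (proj₂ (finite (next i)))) on-true on-false
      where
      on-true : ¬ (M (f (next i)) ≡ true × M (f i) ≡ true × M (f' (next i)) ≡ false × M (f' i) ≡ false)
      on-true (a , b , c , d) = Restriction.separates i true (λ { true → a ; false → b }) (λ { true → c ; false → d })
      on-false : ¬ (M (f (next i)) ≡ false × M (f i) ≡ false × M (f' (next i)) ≡ true × M (f' i) ≡ true)
      on-false (a , b , c , d) = Restriction.separates i false (λ { true → c ; false → d }) (λ { true → a ; false → b })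

    f≡f' : k % 2 ≡ 1 → (∀ i → ∃ λ n → HasSize (V (G i)) n) → ∀ i → M (f i) ≡ M (f' i)
    f≡f' k-odd finite i with M (f i) Bool.≟ M (f' i)
    ... | yes same = same
    ... | no differ = ⊥-elim (odd-cycle-no-alternation k-odd (λ i → M (f i) ≢ M (f' i)) (M ∘ f)
                        (λ i → proj₁ ∘ alternation finite i) (λ i → proj₂ ∘ alternation finite i) i differ)

  equivalent-C : k % 2 ≡ 1 → (∀ i → ∃ λ n → HasSize (V (G i)) n) → ∀ i → EquivalentSet C (pair C (f i) (f' i))
  equivalent-C k-odd finite i = (f i , pair-≡ˡ C (f i) (f' i)) , λ M perfect → both-or-neither M (Matching.f≡f' M perfect k-odd finite i)
    where
    on-pair : ∀ (M : EdgeSet C) b → M (f i) ≡ b → M (f' i) ≡ b → ∀ g → pair C (f i) (f' i) g ≡ true → M g ≡ b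
    on-pair M b p q g g∈ with pair-cases C (f i) (f' i) g g∈
    ... | inj₁ refl = p
    ... | inj₂ refl = q
    both-or-neither : ∀ (M : EdgeSet C) → M (f i) ≡ M (f' i) →
      (∀ g → pair C (f i) (f' i) g ≡ true → M g ≡ false) ⊎ (∀ g → pair C (f i) (f' i) g ≡ true → M g ≡ true)
    both-or-neither M same = by-value (M (f i)) refl
      where
      by-value : ∀ b → M (f i) ≡ b →
        (∀ g → pair C (f i) (f' i) g ≡ true → M g ≡ false) ⊎ (∀ g → pair C (f i) (f' i) g ≡ true → M g ≡ true)
      by-value false p = inj₁ (on-pair M false p (trans (sym same) p))
      by-value true p = inj₂ (on-pair M true p (trans (sym same) p))

  project : (i : Fin k) → V C → V (G i)
  project i (j , v) with j Fin.≟ i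
  ... | yes refl = v
  ... | no _ = x i

  project-≡ : ∀ {i v} w → (i , v) ≡ w → project i w ≡ v
  project-≡ {i} (.i , v) refl with i Fin.≟ i
  ... | yes refl = refl
  ... | no i≢i = ⊥-elim (i≢i refl)

  zone-within : ∀ {S : V C → Bool} i ys → (∀ {v} → S (i , v) ≡ true → (i , v) ∈ ys) →
    Within (λ v → S (i , v)) (map (project i) ys)
  zone-within i ys narrow v Sv = subst (_∈ map (project i) ys) (project-≡ _ refl) (∈-map⁺ (project i) (narrow Sv))

  module Connectivity (four-connected : ∀ i → KConnected (G i) 4) (S : V C → Bool) where

    module Conn (i : Fin k) = Zone.Connectivity i (four-connected i)

    Path : V C → V C → Set
    Path = WalkAvoiding C S

    lift : ∀ i {u v} → WalkAvoiding (G⁻ i) (λ v → S (i , v)) u v → Path (i , u) (i , v)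
    lift i = WalkAvoiding-map {G⁻ i} {C} (i ,_) {S = λ v → S (i , v)} {S′ = S} (λ _ p → p) λ {a} {u} {v} a-b _ _ → inj₁ (i , a) , lift-Adj {a} {u} {v} a-b
      where
      lift-Adj : ∀ {a u v} → Adj (G⁻ i) a u v → Adj C (inj₁ (i , a)) (i , u) (i , v)
      lift-Adj (inj₁ (p , q)) = inj₁ (cong (i ,_) p , cong (i ,_) q)
      lift-Adj (inj₂ (p , q)) = inj₂ (cong (i ,_) p , cong (i ,_) q)

    Link : Fin k → Set
    Link j = Σ Bool λ s → ∀ t → S (f-end j s t) ≡ false

    cross : ∀ j s → (∀ t → S (f-end j s t) ≡ false) → Path (f-end j s true) (f-end j s false)
    cross j s free = step (inj₂ (j , s)) (free true) (inj₁ (endAt-f j s true , endAt-f j s false)) (stay (free false))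

    blocked : ∀ j → ¬ Link j → ∀ s → Σ Bool λ t → S (f-end j s t) ≡ true
    blocked j no-link s with S (f-end j s true) in p | S (f-end j s false) in q
    ... | true | _ = true , p
    ... | false | true = false , q
    ... | false | false = ⊥-elim (no-link (s , λ { true → p ; false → q }))

    link? : ∀ j → Dec (Link j)
    link? j with free? true | free? false
      where
      free? : ∀ s → Dec (∀ t → S (f-end j s t) ≡ false)
      free? s with S (f-end j s true) Bool.≟ false | S (f-end j s false) Bool.≟ false
      ... | yes p | yes q = yes λ { true → p ; false → q }
      ... | no ¬p | _ = no λ free → ¬p (free true)
      ... | _ | no ¬q = no λ free → ¬q (free false)
    ... | yes free | _ = yes (true , free)
    ... | _ | yes free = yes (false , free)
    ... | no ¬t | no ¬f = no λ { (true , free) → ¬t free ; (false , free) → ¬f free }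

    f-zone≢ : ∀ {i*} j t → j ≢ i* → next j ≢ i* → f-zone j t ≢ i*
    f-zone≢ j true j≢ _ = j≢
    f-zone≢ j false _ nj≢ = nj≢

    Exit : Fin k → V C → Set
    Exit i* w = Σ (V C) λ w′ → proj₁ w′ ≢ i* × S w′ ≡ false × Path w w′

    -- walk along the path of zones next i*, next (next i*), …, prev i*, crossing each link by an f-edge
    module AroundCycle (i* : Fin k)
      (zone-connected : ∀ j → j ≢ i* → ∀ u v → S (j , u) ≡ false → S (j , v) ≡ false → Path (j , u) (j , v))
      (links : ∀ j → j ≢ i* → next j ≢ i* → Link j)
      (r₀ : V (G (next i*))) (Sr₀ : S (next i* , r₀) ≡ false) where

      private
        away : ∀ t → suc t < k → next^ t (next i*) ≢ i*
        away t t+1<k eq = next^-moves (suc t) i* (s≤s z≤n) t+1<k (trans (sym (next^-next t i*)) eq)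

        reach : ∀ t → suc t < k → ∀ v → S (next^ t (next i*) , v) ≡ false → Path (next i* , r₀) (next^ t (next i*) , v)
        reach zero t+1<k v Sv = zone-connected (next i*) (away 0 t+1<k) r₀ v Sr₀ Sv
        reach (suc t) t+2<k v Sv with links (next^ t (next i*)) (away t (ℕ.<-trans (ℕ.n<1+n (suc t)) t+2<k)) (away (suc t) t+2<k)
        ... | s , free = WalkAvoiding-trans C (reach t (ℕ.<-trans (ℕ.n<1+n (suc t)) t+2<k) _ (free true))
                           (WalkAvoiding-trans C (cross _ s free)
                             (zone-connected _ (away (suc t) t+2<k) _ v (free false) Sv))

        position : ∀ j → j ≢ i* → Σ ℕ λ t → suc t < k × next^ t (next i*) ≡ j
        position j j≢i* with next^-reaches (next i*) j
        ... | t , t<k , eq with suc t <? k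
        ...   | yes t+1<k = t , t+1<k , eq
        ...   | no t+1≮k = ⊥-elim (j≢i* (begin
                  j                       ≡⟨ eq ⟨
                  next^ t (next i*)       ≡⟨ next^-next t i* ⟩
                  next^ (suc t) i*        ≡⟨ cong (λ z → next^ z i*) (ℕ.≤-antisym t<k (ℕ.≮⇒≥ t+1≮k)) ⟩
                  next^ k i*              ≡⟨ next^-k i* ⟩
                  i*                      ∎))
          where open ≡-Reasoning

        from-base : ∀ w → proj₁ w ≢ i* → S w ≡ false → Path (next i* , r₀) w
        from-base (j , v) j≢i* Sw with position j j≢i*
        ... | t , t+1<k , refl = reach t t+1<k v Sw

      connected : (∀ v → S (i* , v) ≡ false → Exit i* (i* , v)) → ConnectedAfterDeleting C S
      connected exit u v Su Sv = WalkAvoiding-trans C (to-hub u Su) (WalkAvoiding-sym C (to-hub v Sv))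
        where
        to-hub : ∀ w → S w ≡ false → Path w (next i* , r₀)
        to-hub (j , v) Sw with j Fin.≟ i*
        ... | no j≢i* = WalkAvoiding-sym C (from-base (j , v) j≢i* Sw)
        ... | yes refl with exit v Sw
        ...   | w′ , w′≢ , Sw′ , path = WalkAvoiding-trans C path (WalkAvoiding-sym C (from-base w′ w′≢ Sw′))

    port-injective-C : ∀ {j j′} s t s′ t′ → _≡_ {A = V C} (j , port j s t) (j′ , port j′ s′ t′) → j ≡ j′ × s ≡ s′ × t ≡ t′
    port-injective-C s t s′ t′ p with split≡ p
    ... | q , q′ = q , port-injectiveᶜ s t s′ t′ q q′

    module Partner (i* : Fin k) where

      partner : Bool → Bool → V C
      partner s true = next i* , port (next i*) s false
      partner s false = prev i* , port (prev i*) s true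

      partner-zone : ∀ s t → proj₁ (partner s t) ≢ i*
      partner-zone s true = next≢ i*
      partner-zone s false = prev-moves (ℕ.≤-trans (s≤s (s≤s z≤n)) 3≤k) i*

      partner-step : ∀ s t → S (i* , port i* s t) ≡ false → S (partner s t) ≡ false → Path (i* , port i* s t) (partner s t)
      partner-step s true p q = cross i* s λ { true → p ; false → q }
      partner-step s false p q = subst (λ z → Path (z , port z s false) (prev i* , port (prev i*) s true)) (next-prev i*)
        (WalkAvoiding-sym C (cross (prev i*) s λ { true → q ; false → subst (λ z → S (z , port z s false) ≡ false) (sym (next-prev i*)) p }))

      partner-injective : ∀ {s t s′ t′} → partner s t ≡ partner s′ t′ → (s , t) ≡ (s′ , t′)
      partner-injective {s} {true} {s′} {true} p with port-injective-C s false s′ false p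
      ... | _ , refl , _ = refl
      partner-injective {s} {false} {s′} {false} p with port-injective-C s true s′ true p
      ... | _ , refl , _ = refl
      partner-injective {t = true} {t′ = false} p = ⊥-elim (next≢prev 3≤k i* (zone≡ p))
      partner-injective {t = false} {t′ = true} p = ⊥-elim (next≢prev 3≤k i* (sym (zone≡ p)))

      exit-via-port : ∀ v s t → WalkAvoiding (G⁻ i*) (λ v → S (i* , v)) v (port i* s t) → S (partner s t) ≡ false → Exit i* (i* , v)
      exit-via-port v s t walk free = partner s t , partner-zone s t , free ,
        WalkAvoiding-trans C (lift i* walk) (partner-step s t (WalkAvoiding-end C (lift i* walk)) free)

    -- two of the (at most three) deleted vertices lie in one zone i*, the third is c
    module TwoInOneZone (a b c : V C) (within : Within S (a ∷ b ∷ c ∷ [])) (same-zone : proj₁ a ≡ proj₁ b) where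

      i* = proj₁ a
      open Partner i*

      only-c : ∀ w → S w ≡ true → proj₁ w ≢ i* → w ≡ c
      only-c w Sw w≢ with within w Sw
      ... | here refl = ⊥-elim (w≢ refl)
      ... | there (here refl) = ⊥-elim (w≢ (sym same-zone))
      ... | there (there (here w≡c)) = w≡c

      zone-connected : ∀ j → j ≢ i* → ∀ u v → S (j , u) ≡ false → S (j , v) ≡ false → Path (j , u) (j , v)
      zone-connected j j≢ u v Su Sv =
        lift j (Conn.H⁻-connected j {λ v → S (j , v)} (map (project j) (c ∷ [])) (zone-within {S} j (c ∷ []) λ Sv → here (only-c _ Sv j≢)) (s≤s z≤n) u v Su Sv)

      links : ∀ j → j ≢ i* → next j ≢ i* → Link j
      links j j≢ nj≢ with link? j
      ... | yes link = link
      ... | no no-link with blocked j no-link true | blocked j no-link false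
      ...   | t , p | t′ , p′ = ⊥-elim (false≢true refl (sym (proj₁ (proj₂ (f-end-injective j true t j false t′
                                  (trans (only-c _ p (f-zone≢ j t j≢ nj≢)) (sym (only-c _ p′ (f-zone≢ j t′ j≢ nj≢)))))))))

      exit : ∀ v → S (i* , v) ≡ false → Exit i* (i* , v)
      exit v Sv with proj₁ c Fin.≟ i*
      ... | yes c-inside = one-port (Conn.reaches-port i* {λ v → S (i* , v)} (map (project i*) (a ∷ b ∷ c ∷ []))
                                      (zone-within {S} i* (a ∷ b ∷ c ∷ []) (within _)) (s≤s (s≤s (s≤s z≤n))) {v} Sv)
        where
        in-zone : ∀ {w} → w ∈ a ∷ b ∷ c ∷ [] → proj₁ w ≡ i*
        in-zone (here refl) = refl
        in-zone (there (here refl)) = sym same-zone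
        in-zone (there (there (here refl))) = c-inside
        one-port : (Σ (Bool × Bool) λ l → WalkAvoiding (G⁻ i*) (λ v → S (i* , v)) v (Zone.Port i* l)) → Exit i* (i* , v)
        one-port ((s , t) , walk) = exit-via-port v s t walk (Bool.¬-not λ Sp → partner-zone s t (in-zone (within _ Sp)))
      ... | no c-outside = two-ports (Conn.reaches-two-ports i* {λ v → S (i* , v)} (map (project i*) (a ∷ b ∷ []))
                                        (zone-within {S} i* (a ∷ b ∷ []) narrow) (s≤s (s≤s z≤n)) {v} Sv)
        where
        narrow : ∀ {v} → S (i* , v) ≡ true → (i* , v) ∈ a ∷ b ∷ []
        narrow Sv with within _ Sv
        ... | here p = here p
        ... | there (here p) = there (here p)
        ... | there (there (here refl)) = ⊥-elim (c-outside refl)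
        Walk : Bool × Bool → Set
        Walk l = WalkAvoiding (G⁻ i*) (λ v → S (i* , v)) v (Zone.Port i* l)
        two-ports : (Σ (Bool × Bool) λ l₁ → Σ (Bool × Bool) λ l₂ → l₁ ≢ l₂ × Walk l₁ × Walk l₂) → Exit i* (i* , v)
        two-ports ((s₁ , t₁) , (s₂ , t₂) , l₁≢l₂ , walk₁ , walk₂) = by-value (S (partner s₁ t₁)) refl
          where
          -- at most one of the two partners can be the deleted vertex c
          by-value : ∀ b → S (partner s₁ t₁) ≡ b → Exit i* (i* , v)
          by-value false p₁ = exit-via-port v s₁ t₁ walk₁ p₁
          by-value true p₁ = exit-via-port v s₂ t₂ walk₂ (Bool.¬-not λ p₂ → l₁≢l₂ (partner-injective
                               (trans (only-c _ p₁ (partner-zone s₁ t₁)) (sym (only-c _ p₂ (partner-zone s₂ t₂))))))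

      connected : ConnectedAfterDeleting C S
      connected = AroundCycle.connected i* zone-connected links (proj₁ base) (proj₂ base) exit
        where
        base : Σ (V (G (next i*))) λ v → S (next i* , v) ≡ false
        base = Conn.avoided-vertex (next i*) {λ v → S (next i* , v)} (map (project (next i*)) (c ∷ []))
                 (zone-within {S} (next i*) (c ∷ []) λ Sv → here (only-c _ Sv (next≢ i*))) (s≤s z≤n)

    -- every zone contains at most one deleted vertex, so at most one link is broken: cut the cycle there
    module SpreadOut (w₁ w₂ w₃ : V C) (within : Within S (w₁ ∷ w₂ ∷ w₃ ∷ []))
      (d₁₂ : proj₁ w₁ ≢ proj₁ w₂) (d₁₃ : proj₁ w₁ ≢ proj₁ w₃) (d₂₃ : proj₁ w₂ ≢ proj₁ w₃) where

      Narrow : Fin k → List (V C) → Set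
      Narrow j ys = ∀ {v} → S (j , v) ≡ true → (j , v) ∈ ys

      at-most-one : ∀ j → Σ (List (V C)) λ ys → length ys ≤ 1 × Narrow j ys
      at-most-one j with j Fin.≟ proj₁ w₁ | j Fin.≟ proj₁ w₂ | j Fin.≟ proj₁ w₃
      ... | yes refl | _ | _ = w₁ ∷ [] , s≤s z≤n , λ Sv → only₁ (within _ Sv)
        where
        only₁ : ∀ {v} → (proj₁ w₁ , v) ∈ w₁ ∷ w₂ ∷ w₃ ∷ [] → (proj₁ w₁ , v) ∈ w₁ ∷ []
        only₁ (here p) = here p
        only₁ (there (here refl)) = ⊥-elim (d₁₂ refl)
        only₁ (there (there (here refl))) = ⊥-elim (d₁₃ refl)
      ... | no j≢₁ | yes refl | _ = w₂ ∷ [] , s≤s z≤n , λ Sv → only₂ (within _ Sv)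
        where
        only₂ : ∀ {v} → (proj₁ w₂ , v) ∈ w₁ ∷ w₂ ∷ w₃ ∷ [] → (proj₁ w₂ , v) ∈ w₂ ∷ []
        only₂ (here refl) = ⊥-elim (j≢₁ refl)
        only₂ (there (here p)) = here p
        only₂ (there (there (here refl))) = ⊥-elim (d₂₃ refl)
      ... | no j≢₁ | no j≢₂ | yes refl = w₃ ∷ [] , s≤s z≤n , λ Sv → only₃ (within _ Sv)
        where
        only₃ : ∀ {v} → (proj₁ w₃ , v) ∈ w₁ ∷ w₂ ∷ w₃ ∷ [] → (proj₁ w₃ , v) ∈ w₃ ∷ []
        only₃ (here refl) = ⊥-elim (j≢₁ refl)
        only₃ (there (here refl)) = ⊥-elim (j≢₂ refl)
        only₃ (there (there (here p))) = here p
      ... | no j≢₁ | no j≢₂ | no j≢₃ = [] , z≤n , λ Sv → none (within _ Sv)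
        where
        none : ∀ {v} → (j , v) ∈ w₁ ∷ w₂ ∷ w₃ ∷ [] → (j , v) ∈ []
        none (here refl) = ⊥-elim (j≢₁ refl)
        none (there (here refl)) = ⊥-elim (j≢₂ refl)
        none (there (there (here refl))) = ⊥-elim (j≢₃ refl)

      zone-connected : ∀ j u v → S (j , u) ≡ false → S (j , v) ≡ false → Path (j , u) (j , v)
      zone-connected j u v Su Sv =
        let (ys , ≤1 , narrow) = at-most-one j in
        lift j (Conn.H⁻-connected j {λ v → S (j , v)} (map (project j) ys) (zone-within {S} j ys narrow)
                 (subst (_≤ 1) (sym (length-map (project j) ys)) ≤1) u v Su Sv)

      same-zone-same : ∀ {j u v} → S (j , u) ≡ true → S (j , v) ≡ true → u ≡ v
      same-zone-same {j} Su Sv = let (ys , ≤1 , narrow) = at-most-one j in vertex≡ (∈-length≤1 ≤1 (narrow Su) (narrow Sv))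

      broken-ends : ∀ j → ¬ Link j → ∀ t → Σ Bool λ s → S (f-end j s t) ≡ true
      broken-ends j no-link = ends (blocked j no-link true) (blocked j no-link false)
        where
        same-end : ∀ t → S (f-end j true t) ≡ true → S (f-end j false t) ≡ true → ⊥
        same-end t p p′ = false≢true refl (sym (proj₁ (Zone.port-injective (f-zone j t) {true} {t} {false} {t} (same-zone-same p p′))))
        ends : (Σ Bool λ t → S (f-end j true t) ≡ true) → (Σ Bool λ t → S (f-end j false t) ≡ true) → ∀ t → Σ Bool λ s → S (f-end j s t) ≡ true
        ends (true , p) (true , p′) = ⊥-elim (same-end true p p′)
        ends (false , p) (false , p′) = ⊥-elim (same-end false p p′)
        ends (true , p) (false , p′) true = true , p
        ends (true , p) (false , p′) false = false , p′
        ends (false , p) (true , p′) true = false , p′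
        ends (false , p) (true , p′) false = true , p

      one-broken : ∀ j j′ → j ≢ j′ → ¬ Link j → ¬ Link j′ → ⊥
      one-broken j j′ j≢j′ no-link no-link′ = ℕ.<-irrefl refl (unique-within⇒length≤ (_≟V_ C)
            ((A≢B ∷ A≢C ∷ A≢D ∷ []) ∷ (B≢C ∷ B≢D ∷ []) ∷ (C≢D ∷ []) ∷ [] ∷ [])
            (within _ (proj₂ (ends true)) ∷ within _ (proj₂ (ends false)) ∷ within _ (proj₂ (ends′ true)) ∷ within _ (proj₂ (ends′ false)) ∷ []))
        where
        ends = broken-ends j no-link
        ends′ = broken-ends j′ no-link′
        differ-t : ∀ {i i′ s s′} → f-end i s true ≢ f-end i′ s′ false
        differ-t p = false≢true refl (sym (proj₂ (proj₂ (f-end-injective _ _ true _ _ false p))))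
        differ-j : ∀ {s s′} t → f-end j s t ≢ f-end j′ s′ t
        differ-j t p = j≢j′ (proj₁ (f-end-injective _ _ t _ _ t p))
        A≢B = differ-t
        A≢C = differ-j true
        A≢D = differ-t
        B≢C = differ-t ∘ sym
        B≢D = differ-j false
        C≢D = differ-t

      module CutAt (i* : Fin k) (links : ∀ j → j ≢ i* → Link j) where
        open Partner i*

        exit : ∀ v → S (i* , v) ≡ false → Exit i* (i* , v)
        exit v Sv = through (links (prev i*) (prev-moves (ℕ.≤-trans (s≤s (s≤s z≤n)) 3≤k) i*))
          where
          through : Link (prev i*) → Exit i* (i* , v)
          through (s , free) = partner s false , partner-zone s false , free true ,
            WalkAvoiding-trans C (zone-connected i* v (port i* s false) Sv Sy) (partner-step s false Sy (free true))
            where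
            Sy : S (i* , port i* s false) ≡ false
            Sy = subst (λ z → S (z , port z s false) ≡ false) (next-prev i*) (free false)

        connected : ConnectedAfterDeleting C S
        connected = AroundCycle.connected i* (λ j _ → zone-connected j) (λ j j≢ _ → links j j≢)
          (proj₁ base) (proj₂ base) exit
          where
          base : Σ (V (G (next i*))) λ v → S (next i* , v) ≡ false
          base = let (ys , ≤1 , narrow) = at-most-one (next i*) in
            Conn.avoided-vertex (next i*) {λ v → S (next i* , v)} (map (project (next i*)) ys) (zone-within {S} (next i*) ys narrow)
              (ℕ.≤-trans (ℕ.≤-reflexive (length-map (project (next i*)) ys)) (ℕ.m≤n⇒m≤o+n 3 ≤1))

      connected : ConnectedAfterDeleting C S
      connected = cut (Fin.any? (¬? ∘ link?))
        where
        cut : Dec (∃ λ b → ¬ Link b) → ConnectedAfterDeleting C S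
        cut (yes (b , no-link)) = CutAt.connected b λ j j≢b → decidable-stable (link? j) (one-broken b j (j≢b ∘ sym) no-link)
        cut (no all-links) = CutAt.connected (proj₁ w₁) λ j _ → decidable-stable (link? j) λ no-link → all-links (j , no-link)

  padded : (zs : List (V C)) → length zs ≤ 3 →
    Σ (V C) λ w₁ → Σ (V C) λ w₂ → Σ (V C) λ w₃ → ∀ {w} → w ∈ zs → w ∈ w₁ ∷ w₂ ∷ w₃ ∷ []
  padded [] _ = (zone₀ , x zone₀) , (zone₀ , x zone₀) , (zone₀ , x zone₀) , λ ()
  padded (a ∷ []) _ = a , a , a , λ { (here p) → here p }
  padded (a ∷ b ∷ []) _ = a , b , b , λ { (here p) → here p ; (there (here p)) → there (here p) }
  padded (a ∷ b ∷ c ∷ []) _ = a , b , c , id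
  padded (_ ∷ _ ∷ _ ∷ _ ∷ _) (s≤s (s≤s (s≤s ())))

  module _ (four-connected : ∀ i → KConnected (G i) 4) where

    connected-within-three : ∀ S w₁ w₂ w₃ → Within S (w₁ ∷ w₂ ∷ w₃ ∷ []) → ConnectedAfterDeleting C S
    connected-within-three S w₁ w₂ w₃ within =
      by-zones (proj₁ w₁ Fin.≟ proj₁ w₂) (proj₁ w₁ Fin.≟ proj₁ w₃) (proj₁ w₂ Fin.≟ proj₁ w₃)
      where
      open Connectivity four-connected S
      by-zones : Dec (proj₁ w₁ ≡ proj₁ w₂) → Dec (proj₁ w₁ ≡ proj₁ w₃) → Dec (proj₁ w₂ ≡ proj₁ w₃) → ConnectedAfterDeleting C S
      by-zones (yes p) _ _ = TwoInOneZone.connected w₁ w₂ w₃ within p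
      by-zones (no _) (yes p) _ = TwoInOneZone.connected w₁ w₃ w₂ (λ w Sw → swap (within w Sw)) p
        where
        swap : ∀ {w} → w ∈ w₁ ∷ w₂ ∷ w₃ ∷ [] → w ∈ w₁ ∷ w₃ ∷ w₂ ∷ []
        swap (here q) = here q
        swap (there (here q)) = there (there (here q))
        swap (there (there (here q))) = there (here q)
      by-zones (no _) (no _) (yes p) = TwoInOneZone.connected w₂ w₃ w₁ (λ w Sw → rotate (within w Sw)) p
        where
        rotate : ∀ {w} → w ∈ w₁ ∷ w₂ ∷ w₃ ∷ [] → w ∈ w₂ ∷ w₃ ∷ w₁ ∷ []
        rotate (here q) = there (there (here q))
        rotate (there (here q)) = here q
        rotate (there (there (here q))) = there (here q)
      by-zones (no d₁₂) (no d₁₃) (no d₂₃) = SpreadOut.connected w₁ w₂ w₃ within d₁₂ d₁₃ d₂₃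

    four-connected-C : KConnected C 4
    four-connected-C = (sumFin order , size-Σ (V ∘ G) order sized , ℕ.<-≤-trans (4<order zone₀) (sumFin-≥ order zone₀)) ,
                       small-cuts
      where
      order : Fin k → ℕ
      order i = proj₁ (proj₁ (four-connected i))
      sized : ∀ i → HasSize (V (G i)) (order i)
      sized i = proj₁ (proj₂ (proj₁ (four-connected i)))
      4<order : ∀ i → 4 < order i
      4<order i = proj₂ (proj₂ (proj₁ (four-connected i)))
      small-cuts : ∀ S j → HasSize (Σ (V C) λ w → S w ≡ true) j → j < 4 → ConnectedAfterDeleting C S
      small-cuts S j ψ (s≤s j≤3) =
        let (w₁ , w₂ , w₃ , pad) = padded zs (subst (_≤ 3) (sym (length-tabulate _)) j≤3)
        in connected-within-three S w₁ w₂ w₃ λ w Sw → pad (listed w Sw)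
        where
        zs : List (V C)
        zs = tabulate (proj₁ ∘ to ψ)
        listed : Within S zs
        listed w Sw = subst (_∈ zs) (cong proj₁ (to-from ψ (w , Sw))) (∈-tabulate⁺ (from ψ (w , Sw)))

  finite : (∀ i → KConnected (G i) 4) → ∀ i → ∃ λ n → HasSize (V (G i)) n
  finite four-connected i = proj₁ (proj₁ (four-connected i)) , proj₁ (proj₂ (proj₁ (four-connected i)))

  F-matched-even : k % 2 ≡ 1 → (∀ i → ∃ λ n → HasSize (V (G i)) n) →
    ∀ M → PerfectMatching C M → ∀ a → InterSize C M F a → 2 ∣ a
  F-matched-even k-odd finite M perfect a ψ with size-fibre-Fin k (M ∘ f) true
  ... | m , φ = divides m (size-unique ψ (↔-trans (size-× φ Fin.2↔Bool) (mk↔ₛ′ forth back forth-back back-forth)))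
    where
    f≡f' = Matching.f≡f' M perfect k-odd finite
    side : ∀ i s → M (f i) ≡ true → M (inj₂ (i , s)) ≡ true
    side i true p = p
    side i false p = trans (sym (f≡f' i)) p
    unside : ∀ i s → M (inj₂ (i , s)) ≡ true → M (f i) ≡ true
    unside i true p = p
    unside i false p = trans (f≡f' i) p
    forth : (Σ (Fin k) λ i → M (f i) ≡ true) × Bool → Σ (E C) λ g → M g ≡ true × F g ≡ true
    forth ((i , p) , s) = inj₂ (i , s) , side i s p , refl
    back : (Σ (E C) λ g → M g ≡ true × F g ≡ true) → (Σ (Fin k) λ i → M (f i) ≡ true) × Bool
    back (inj₂ (i , s) , m , _) = (i , unside i s m) , s
    forth-back : ∀ z → forth (back z) ≡ z
    forth-back (inj₂ (i , s) , m , refl) = cong (λ z → inj₂ (i , s) , z , refl) (≡-irrelevant _ _)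
    back-forth : ∀ z → back (forth z) ≡ z
    back-forth ((i , p) , s) = cong (λ z → (i , z) , s) (≡-irrelevant _ _)

  module _ (k-odd : k % 2 ≡ 1) (four-connected : ∀ i → KConnected (G i) 4) where

    F-non-feasible : ¬ Feasible C F
    F-non-feasible (M₁ , M₂ , perfect₁ , perfect₂ , a , b , ψ₁ , ψ₂ , a≢b) =
      a≢b (trans (n∣m⇒m%n≡0 a 2 (F-matched-even k-odd (finite four-connected) M₁ perfect₁ a ψ₁))
                 (sym (n∣m⇒m%n≡0 b 2 (F-matched-even k-odd (finite four-connected) M₂ perfect₂ b ψ₂))))

    -- U would be constant on each zone and flip across every f-edge, which is impossible around an odd cycle
    F-not-cut : ¬ (_∼_ C F (λ _ → false))
    F-not-cut (U , F≡∇) = odd-cycle-no-alternation k-odd (λ _ → ⊤) (λ i → U (i , x i)) (λ _ _ → tt) flips zone₀ tt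
      where
      constant : ∀ i {u v} → WalkAvoiding (G⁻ i) (λ _ → false) u v → U (i , u) ≡ U (i , v)
      constant i (stay _) = refl
      constant i (step a _ (inj₁ (refl , refl)) w) = trans (xor≡false⇒≡ _ _ (sym (F≡∇ (inj₁ (i , a))))) (constant i w)
      constant i (step a _ (inj₂ (refl , refl)) w) = trans (sym (xor≡false⇒≡ _ _ (sym (F≡∇ (inj₁ (i , a)))))) (constant i w)
      flips : ∀ i → ⊤ → U (next i , x (next i)) ≡ not (U (i , x i))
      flips i _ = trans (sym (constant (next i) (Zone.Connectivity.H⁻-connected (next i) (four-connected (next i))
                    {λ _ → false} [] (λ _ ()) z≤n (y (next i)) (x (next i)) refl refl)))
                    (xor≡true⇒≡not _ _ (sym (F≡∇ (f i))))

    F-not-cocut : (∃ λ j → ¬ Bipartite (G⁻ j)) → ¬ (_∼_ C F (λ _ → true))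
    F-not-cocut (j , non-bipartite) (U , F≡∇) = non-bipartite ((λ v → U (j , v)) , λ a → differ (F≡∇ (inj₁ (j , a))))
      where
      differ : ∀ {b c} → false ≡ not (b xor c) → b ≢ c
      differ {b} {c} p b≡c = Bool.not-¬ refl (trans b≡c (xor≡true⇒≡not b c (Bool.not-injective (sym p))))

    N*-C : (∃ λ j → ¬ Bipartite (G⁻ j)) → NStar C F
    N*-C non-bipartite = F-non-feasible , F-not-cut , F-not-cocut non-bipartite

lemma5p3 : (r k : ℕ) → 1 ≤ r → 3 ≤ k → k % 2 ≡ 1 →
    (G : Fin k → Graph) →
    (∀ i → Loopless (G i)) →
    (∀ i → KConnected (G i) 4) →
    (∀ i → Regular (G i) r) →
    (∀ i → Class1 (G i)) →
    (e e' : (i : Fin k) → E (G i)) →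
    (x y x' y' : (i : Fin k) → V (G i)) →
    (∀ i → e i ≢ e' i) →
    (∀ i → Adj (G i) (e i) (x i) (y i)) →
    (∀ i → Adj (G i) (e' i) (x' i) (y' i)) →
    (∀ i → EquivalentSet (G i) (pair (G i) (e i) (e' i))) →
    let open Construction G e e' x y x' y' in
    (KConnected C 4 × Regular C r × Class1 C ×
       (∀ i → EquivalentSet C (pair C (f i) (f' i))))
    × ((∃ λ j → ¬ Bipartite (G⁻ j)) → NStar C F)
lemma5p3 r k 1≤r 3≤k k-odd G loopless four-connected regular class1 e e′ x y x′ y′ e≢e′ x-y x′-y′ equivalent =
  (four-connected-C four-connected , regular-C , class1-C , equivalent-C k-odd (finite four-connected)) ,
  N*-C k-odd four-connected
  where
  open Chain 3≤k G loopless regular class1 e e′ x y x′ y′ e≢e′ x-y x′-y′ equivalent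
  open Colouring 1≤r
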